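{- There is an online algorithm with advice for the proportional removable knapsack problem \textsc{RemKnap} that reads two advice bits and is strictly $4/3$-competitive.
   Context: \textsc{RemKnap} (proportional removable knapsack) is the following online maximization problem. An instance is a sequence of items $1,\dots,n$ with sizes $s_1,\dots,s_n\in\mathbb{R}_{>0}$; the knapsack has capacity $1$. For a set $A$ of items, $s(A)=\sum_{i\in A}s_i$. The items are revealed one by one; the algorithm starts with the empty packing $A_0=\emptyset$, and when item $i$ is revealed (and only then does it learn $s_i$) it must choose a new packing $A_i\subseteq A_{i-1}\cup\{i\}$ with $s(A_i)\le 1$. Thus it may remove any previously packed items and may pack the new item, but a removed or rejected item can never be packed again. The algorithm learns $n$ only after choosing $A_n$. The gain is $\mathrm{ALG}(I)=s(A_n)$; $\mathrm{OPT}(I)$ is the maximum of $s(A)$ over all subsets $A$ of the items with $s(A)\le1$. In the advice model, an omniscient oracle that knows the whole instance writes a binary advice string that the algorithm may read. An algorithm is strictly $\rho$-competitive if $\mathrm{OPT}(I)/\mathrm{ALG}(I)\le\rho$ for every instance $I$.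
   Formalization: The item sizes $s_1,\dots,s_n$ are positive rationals instead of positive reals. -}

module Defs where

open import Data.Bool using (Bool; true; false; _∧_)
open import Data.Nat using (ℕ)
open import Data.Vec using (Vec; []; _∷_; zipWith)
open import Data.Product using (_×_; _,_; Σ; ∃; proj₁; proj₂)
open import Data.Unit using (⊤)
open import Data.Integer using (+_)
open import Data.Rational using (ℚ; 0ℚ; 1ℚ; _+_; _*_; _≤_; _<_; _/_)
open import Data.Vec.Relation.Unary.All using (All)

-- Convention: an instance (or a history) of length n is a Vec ℚ n listed
-- from the MOST RECENTLY revealed item to the first one, i.e.
-- (x ∷ xs) is the instance xs followed by the newly revealed item x.
-- A packing of such a history is a Vec Bool of the same length
-- (true = item currently in the knapsack).

packedSize : ∀ {n} → Vec ℚ n → Vec Bool n → ℚ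
packedSize []       []           = 0ℚ
packedSize (x ∷ xs) (true  ∷ bs) = x + packedSize xs bs
packedSize (x ∷ xs) (false ∷ bs) = packedSize xs bs

Advice : Set
Advice = Vec Bool 2

-- When a new item of size x
-- is revealed, it sees the advice, the sizes revealed so far, its current
-- packing A_{i-1}, and x; it returns which previously packed items to keep
-- and whether to pack the new item.  Hence A_i ⊆ A_{i-1} ∪ {i} holds by
-- construction, and removed/rejected items can never come back.
-- The algorithm is never told n.
record OnlineAlg : Set where
  field
    step : Advice → ∀ {i} → Vec ℚ i → Vec Bool i → ℚ → Vec Bool i × Bool

open OnlineAlg public

pack : OnlineAlg → Advice → ∀ {n} → Vec ℚ n → Vec Bool n
pack A a []       = []
pack A a (x ∷ xs) with step A a xs (pack A a xs) x
... | keep , t = t ∷ zipWith _∧_ keep (pack A a xs)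

AllFit : OnlineAlg → Advice → ∀ {n} → Vec ℚ n → Set
AllFit A a []       = ⊤
AllFit A a (x ∷ xs) = (packedSize (x ∷ xs) (pack A a (x ∷ xs)) ≤ 1ℚ) × AllFit A a xs

gain : OnlineAlg → Advice → ∀ {n} → Vec ℚ n → ℚ
gain A a xs = packedSize xs (pack A a xs)

-- Strict ρ-competitiveness with advice given by an oracle:
-- for every instance with positive sizes, the run is feasible and
-- OPT(I) ≤ ρ · ALG(I), where OPT(I) ≤ c is unfolded as
-- "every subset of the items of size ≤ 1 has size ≤ c".
StrictlyCompetitive : ℚ → OnlineAlg → (∀ {n} → Vec ℚ n → Advice) → Set
StrictlyCompetitive ρ A oracle =
  ∀ {n} (I : Vec ℚ n) → All (λ x → 0ℚ < x) I →
    AllFit A (oracle I) I ×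
    (∀ (S : Vec Bool n) → packedSize I S ≤ 1ℚ →
       packedSize I S ≤ ρ * gain A (oracle I) I)

four-thirds : ℚ
four-thirds = + 4 / 3

{-# OPTIONS --safe #-}
-- Call an item small (≤ ¼), medium (¼, ½], large (½, ¾), huge [¾, 1] or oversized (> 1), and
-- big if it is medium or large.  A packing of size at least ¾ is 4/3-competitive because
-- OPT ≤ 1, so the algorithm freezes as soon as it reaches ¾.  Before that every small item
-- fits, and making room for a big item drops a small one only if the packing then exceeds ¾,
-- so a run that never reaches ¾ holds every small item.  The two advice bits select one of
-- four policies for big items; the oracle names the first of the first three whose run
-- reaches ¾.  If none does, their runs certify that the instance has no huge item, that no
-- medium and large item fit together, that no three mediums fit together, and that any two
-- mediums sum to less than ¾.  The big items of a feasible set are then at most one item or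
-- two mediums, and the fourth policy, which holds the largest large item or else the pair of
-- mediums of largest sum, holds at least ¾ of their size.
module Submission where

open import Defs
open import Algebra.Bundles using (CommutativeMonoid)
open import Data.Bool using (Bool; true; false; _∧_; if_then_else_)
open import Data.Bool.Properties using (∧-identityˡ)
open import Data.Empty using (⊥; ⊥-elim)
import Data.Integer as ℤ
open import Data.List using (List; []; _∷_)
open import Data.List.Relation.Unary.All using ([]; _∷_) renaming (All to Allᴸ)
open import Data.List.Relation.Unary.AllPairs using ([]; _∷_) renaming (AllPairs to AllPairsᴸ)
open import Data.Nat using (ℕ; zero; suc)
open import Data.Product using (Σ; _×_; _,_; proj₁; proj₂)
open import Data.Rational using (ℚ; 0ℚ; 1ℚ; ½; _+_; _*_; _≤_; _<_; _/_; nonNegative)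
open import Data.Rational.Properties
open import Data.Sum using (_⊎_; inj₁; inj₂; swap)
open import Data.Unit using (⊤; tt)
open import Data.Vec using (Vec; []; _∷_; zipWith; replicate)
open import Data.Vec.Properties using (zipWith-identityˡ)
open import Data.Vec.Relation.Unary.All as All using (All; []; _∷_)
open import Data.Vec.Relation.Unary.Any as Any using (Any; here; there)
open import Data.Vec.Relation.Unary.AllPairs as AllPairs using (AllPairs; []; _∷_)
open import Relation.Nullary using (¬_; Dec; yes; no)
open import Relation.Nullary.Decidable using (⌊_⌋; toWitness)
open import Relation.Binary.PropositionalEquality
open import Algebra.Properties.CommutativeSemigroup
  (CommutativeMonoid.commutativeSemigroup +-0-commutativeMonoid) using (x∙yz≈y∙xz; interchange)

¼ ¾ ⅝ : ℚ
¼ = ℤ.+ 1 / 4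
¾ = ℤ.+ 3 / 4
⅝ = ℤ.+ 5 / 8

0<¼ : 0ℚ < ¼
0<¼ = toWitness {a? = 0ℚ <? ¼} tt

¼<½ : ¼ < ½
¼<½ = toWitness {a? = ¼ <? ½} tt

½<¾ : ½ < ¾
½<¾ = toWitness {a? = ½ <? ¾} tt

¾<1 : ¾ < 1ℚ
¾<1 = toWitness {a? = ¾ <? 1ℚ} tt

¼<¾ : ¼ < ¾
¼<¾ = <-trans ¼<½ ½<¾

½<1 : ½ < 1ℚ
½<1 = <-trans ½<¾ ¾<1

¼<1 : ¼ < 1ℚ
¼<1 = <-trans ¼<½ ½<1

<⇒≱ : ∀ {p q} → p < q → ¬ (q ≤ p)
<⇒≱ p<q q≤p = <-irrefl refl (<-≤-trans p<q q≤p)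

p≤p+q : ∀ p {q} → 0ℚ ≤ q → p ≤ p + q
p≤p+q p {q} 0≤q = subst (_≤ p + q) (+-identityʳ p) (+-monoʳ-≤ p 0≤q)

p≤q+p : ∀ p {q} → 0ℚ ≤ q → p ≤ q + p
p≤q+p p {q} 0≤q = subst (p ≤_) (+-comm p q) (p≤p+q p 0≤q)

≤⇒≤four-thirds* : ∀ {p q} → 0ℚ ≤ q → p ≤ q → p ≤ four-thirds * q
≤⇒≤four-thirds* {p} {q} 0≤q p≤q = ≤-trans p≤q (subst (_≤ four-thirds * q) (*-identityˡ q)
  (*-monoʳ-≤-nonNeg q {{nonNegative 0≤q}} (toWitness {a? = 1ℚ ≤? four-thirds} tt)))

-- Size classes

Medium Large : ℚ → Set
Medium x = ¼ < x × x ≤ ½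
Large  x = ½ < x × x < ¾

medium⇒pos : ∀ {x} → Medium x → 0ℚ < x
medium⇒pos (¼<x , _) = <-trans 0<¼ ¼<x

Big : ℚ → Set
Big x = Medium x ⊎ Large x

data SizeClass (x : ℚ) : Set where
  small     : x ≤ ¼ → SizeClass x
  medium    : Medium x → SizeClass x
  large     : Large x → SizeClass x
  huge      : ¾ ≤ x → x ≤ 1ℚ → SizeClass x
  oversized : 1ℚ < x → SizeClass x

classify : ∀ x → SizeClass x
classify x with x ≤? ¼ | x ≤? ½ | x <? ¾ | x ≤? 1ℚ
... | yes s | _     | _     | _     = small s
... | no s  | yes m | _     | _     = medium (≰⇒> s , m)
... | no _  | no m  | yes l | _     = large (≰⇒> m , l)
... | no _  | no _  | no l  | yes h = huge (≮⇒≥ l) h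
... | no _  | no _  | no _  | no h  = oversized (≰⇒> h)

isBigClass : ∀ {x} → SizeClass x → Bool
isBigClass (medium _) = true
isBigClass (large _)  = true
isBigClass _          = false

isBig : ℚ → Bool
isBig x = isBigClass (classify x)

medium⇒¬large : ∀ {x} → Medium x → ¬ Large x
medium⇒¬large (_ , x≤½) (½<x , _) = <⇒≱ ½<x x≤½

small⇒¬medium : ∀ {x} → x ≤ ¼ → ¬ Medium x
small⇒¬medium x≤¼ (¼<x , _) = <⇒≱ ¼<x x≤¼

small⇒¬large : ∀ {x} → x ≤ ¼ → ¬ Large x
small⇒¬large x≤¼ (½<x , _) = <⇒≱ (<-trans ¼<½ ½<x) x≤¼

oversized⇒¬medium : ∀ {x} → 1ℚ < x → ¬ Medium x
oversized⇒¬medium 1<x (_ , x≤½) = <⇒≱ (<-trans ½<1 1<x) x≤½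

oversized⇒¬large : ∀ {x} → 1ℚ < x → ¬ Large x
oversized⇒¬large 1<x (_ , x<¾) = <⇒≱ (<-trans ¾<1 1<x) (<⇒≤ x<¾)

sum : List ℚ → ℚ
sum []       = 0ℚ
sum (x ∷ xs) = x + sum xs

sum-[y] : ∀ y → sum (y ∷ []) ≡ y
sum-[y] = +-identityʳ

sum-[y,z] : ∀ y z → sum (y ∷ z ∷ []) ≡ y + z
sum-[y,z] y z = cong (y +_) (+-identityʳ z)

bigItems : ∀ {n} → Vec ℚ n → Vec Bool n → List ℚ
bigItems []       []           = []
bigItems (x ∷ xs) (false ∷ bs) = bigItems xs bs
bigItems (x ∷ xs) (true  ∷ bs) = if isBig x then x ∷ bigItems xs bs else bigItems xs bs

nonBigSize : ∀ {n} → Vec ℚ n → Vec Bool n → ℚ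
nonBigSize []       []           = 0ℚ
nonBigSize (x ∷ xs) (false ∷ bs) = nonBigSize xs bs
nonBigSize (x ∷ xs) (true  ∷ bs) = if isBig x then nonBigSize xs bs else x + nonBigSize xs bs

addIfSmall : ∀ {x} → SizeClass x → ℚ → ℚ
addIfSmall {x} (small _) s = x + s
addIfSmall     _         s = s

smallTotal : ∀ {n} → Vec ℚ n → ℚ
smallTotal []       = 0ℚ
smallTotal (x ∷ xs) = addIfSmall (classify x) (smallTotal xs)

-- The algorithm

data Removal : Set where
  keepAll dropAll : Removal
  dropAt : ℕ → Removal

keepsHead : Removal → Bool
keepsHead keepAll          = true
keepsHead dropAll          = false
keepsHead (dropAt zero)    = false
keepsHead (dropAt (suc k)) = true

tailRemoval : Removal → Removal
tailRemoval keepAll          = keepAll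
tailRemoval dropAll          = dropAll
tailRemoval (dropAt zero)    = keepAll
tailRemoval (dropAt (suc k)) = dropAt k

removeAt : ℕ → List ℚ → List ℚ
removeAt k       []       = []
removeAt zero    (x ∷ xs) = xs
removeAt (suc k) (x ∷ xs) = x ∷ removeAt k xs

applyRemoval : Removal → List ℚ → List ℚ
applyRemoval keepAll    xs = xs
applyRemoval dropAll    xs = []
applyRemoval (dropAt k) xs = removeAt k xs

retain : Removal → ℚ → ∀ {n} → Vec ℚ n → Vec Bool n → Vec Bool n
retain r t []       []           = []
retain r t (x ∷ xs) (false ∷ bs) = false ∷ retain r t xs bs
retain r t (x ∷ xs) (true  ∷ bs) =
  if isBig x then keepsHead r ∷ retain (tailRemoval r) t xs bs
  else (if ⌊ t + x ≤? 1ℚ ⌋ then true ∷ retain r (t + x) xs bs else false ∷ retain r t xs bs)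

data Decision : Set where
  reject : Decision
  accept : Removal → Decision

record Policy : Set where
  field
    onMedium onLarge : List ℚ → ℚ → Decision

open Policy

bigLoad : Removal → ℚ → List ℚ → ℚ
bigLoad r x held = x + sum (applyRemoval r held)

keepOld : ∀ {i} → Vec Bool i
keepOld = replicate _ true

acceptWith : ∀ {i} (xs : Vec ℚ i) (bs : Vec Bool i) (x : ℚ) (r : Removal) →
             Dec (bigLoad r x (bigItems xs bs) ≤ 1ℚ) → Vec Bool i × Bool
acceptWith xs bs x r (yes _) = retain r (bigLoad r x (bigItems xs bs)) xs bs , true
acceptWith xs bs x r (no _)  = keepOld , false

perform : ∀ {i} (xs : Vec ℚ i) (bs : Vec Bool i) (x : ℚ) → Decision → Vec Bool i × Bool
perform xs bs x reject     = keepOld , false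
perform xs bs x (accept r) = acceptWith xs bs x r (bigLoad r x (bigItems xs bs) ≤? 1ℚ)

respond : Policy → ∀ {i} (xs : Vec ℚ i) (bs : Vec Bool i) (x : ℚ) → SizeClass x → Vec Bool i × Bool
respond p xs bs x (small _)     = keepOld , true
respond p xs bs x (medium _)    = perform xs bs x (onMedium p (bigItems xs bs) x)
respond p xs bs x (large _)     = perform xs bs x (onLarge p (bigItems xs bs) x)
respond p xs bs x (huge _ _)    = replicate _ false , true
respond p xs bs x (oversized _) = keepOld , false

stepBy : Policy → ∀ {i} (xs : Vec ℚ i) (bs : Vec Bool i) (x : ℚ) → Dec (¾ ≤ packedSize xs bs) →
         Vec Bool i × Bool
stepBy p xs bs x (yes _) = keepOld , false
stepBy p xs bs x (no _)  = respond p xs bs x (classify x)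

policyStep : Policy → ∀ {i} → Vec ℚ i → Vec Bool i → ℚ → Vec Bool i × Bool
policyStep p xs bs x = stepBy p xs bs x (¾ ≤? packedSize xs bs)

smallestLarge twoSmallestMedium largestMedium largestBig : Policy

onMedium smallestLarge (h ∷ []) x = if ⌊ h + x ≤? 1ℚ ⌋ then accept keepAll else reject
onMedium smallestLarge _        x = reject
onLarge  smallestLarge []       x = accept keepAll
onLarge  smallestLarge (h ∷ []) x = if ⌊ x <? h ⌋ then accept dropAll else reject
onLarge  smallestLarge _        x = reject

onMedium twoSmallestMedium []             x = accept keepAll
onMedium twoSmallestMedium (h ∷ [])       x = accept keepAll
onMedium twoSmallestMedium (h₁ ∷ h₂ ∷ []) x =
  if ⌊ x + sum (h₁ ∷ h₂ ∷ []) ≤? 1ℚ ⌋ then accept keepAll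
  else if ⌊ h₁ ≤? h₂ ⌋ then (if ⌊ x <? h₂ ⌋ then accept (dropAt 1) else reject)
  else (if ⌊ x <? h₁ ⌋ then accept (dropAt 0) else reject)
onMedium twoSmallestMedium _              x = reject
onLarge  twoSmallestMedium (h ∷ [])       x = if ⌊ h + x ≤? 1ℚ ⌋ then accept keepAll else reject
onLarge  twoSmallestMedium (h₁ ∷ h₂ ∷ []) x =
  if ⌊ h₁ ≤? h₂ ⌋ then (if ⌊ h₁ + x ≤? 1ℚ ⌋ then accept (dropAt 1) else reject)
  else (if ⌊ h₂ + x ≤? 1ℚ ⌋ then accept (dropAt 0) else reject)
onLarge  twoSmallestMedium _              x = reject

onMedium largestMedium []       x = accept keepAll
onMedium largestMedium (h ∷ []) x =
  if ⌊ ¾ ≤? h + x ⌋ then accept keepAll else (if ⌊ h <? x ⌋ then accept dropAll else reject)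
onMedium largestMedium _        x = reject
onLarge  largestMedium _        x = reject

onMedium largestBig []             x = accept keepAll
onMedium largestBig (h ∷ [])       x = if ⌊ ½ <? h ⌋ then reject else accept keepAll
onMedium largestBig (h₁ ∷ h₂ ∷ []) x =
  if ⌊ h₁ ≤? h₂ ⌋ then (if ⌊ h₁ <? x ⌋ then accept (dropAt 0) else reject)
  else (if ⌊ h₂ <? x ⌋ then accept (dropAt 1) else reject)
onMedium largestBig _              x = reject
onLarge  largestBig (h ∷ [])       x =
  if ⌊ ½ <? h ⌋ then (if ⌊ h <? x ⌋ then accept dropAll else reject) else accept dropAll
onLarge  largestBig _              x = accept dropAll

advice₁ advice₂ advice₃ advice₄ : Advice
advice₁ = false ∷ false ∷ []
advice₂ = false ∷ true  ∷ []
advice₃ = true  ∷ false ∷ []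
advice₄ = true  ∷ true  ∷ []

policyFor : Advice → Policy
policyFor (false ∷ false ∷ []) = smallestLarge
policyFor (false ∷ true  ∷ []) = twoSmallestMedium
policyFor (true  ∷ false ∷ []) = largestMedium
policyFor (true  ∷ true  ∷ []) = largestBig

algorithm : OnlineAlg
step algorithm a = policyStep (policyFor a)

extend : ∀ {n} → Vec Bool n × Bool → Vec Bool n → Vec Bool (suc n)
extend (keep , new) bs = new ∷ zipWith _∧_ keep bs

pack-∷ : ∀ a {n} x (xs : Vec ℚ n) →
         pack algorithm a (x ∷ xs) ≡
         extend (step algorithm a xs (pack algorithm a xs) x) (pack algorithm a xs)
pack-∷ a x xs with step algorithm a xs (pack algorithm a xs) x
... | keep , new = refl

keepOld-∧ : ∀ {n} (bs : Vec Bool n) → zipWith _∧_ keepOld bs ≡ bs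
keepOld-∧ = zipWith-identityˡ ∧-identityˡ

AllPositive : ∀ {n} → Vec ℚ n → Set
AllPositive = All (0ℚ <_)

sum-nonNeg : ∀ {xs} → Allᴸ (0ℚ <_) xs → 0ℚ ≤ sum xs
sum-nonNeg []       = ≤-refl
sum-nonNeg (p ∷ ps) = +-mono-≤ (<⇒≤ p) (sum-nonNeg ps)

packedSize-nonNeg : ∀ {n} {xs : Vec ℚ n} bs → AllPositive xs → 0ℚ ≤ packedSize xs bs
packedSize-nonNeg []           []       = ≤-refl
packedSize-nonNeg (false ∷ bs) (_ ∷ ps) = packedSize-nonNeg bs ps
packedSize-nonNeg (true  ∷ bs) (p ∷ ps) = +-mono-≤ (<⇒≤ p) (packedSize-nonNeg bs ps)

nonBigSize-nonNeg : ∀ {n} {xs : Vec ℚ n} bs → AllPositive xs → 0ℚ ≤ nonBigSize xs bs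
nonBigSize-nonNeg                []           []       = ≤-refl
nonBigSize-nonNeg                (false ∷ bs) (_ ∷ ps) = nonBigSize-nonNeg bs ps
nonBigSize-nonNeg {xs = x ∷ xs} (true  ∷ bs) (p ∷ ps) with isBig x
... | true  = nonBigSize-nonNeg bs ps
... | false = +-mono-≤ (<⇒≤ p) (nonBigSize-nonNeg bs ps)

packedSize-dropAll : ∀ {n} (xs : Vec ℚ n) bs → packedSize xs (zipWith _∧_ (replicate _ false) bs) ≡ 0ℚ
packedSize-dropAll []       []       = refl
packedSize-dropAll (x ∷ xs) (_ ∷ bs) = packedSize-dropAll xs bs

packedSize-split : ∀ {n} (xs : Vec ℚ n) bs → packedSize xs bs ≡ sum (bigItems xs bs) + nonBigSize xs bs
packedSize-split []       []           = refl
packedSize-split (x ∷ xs) (false ∷ bs) = packedSize-split xs bs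
packedSize-split (x ∷ xs) (true  ∷ bs) with isBig x
... | true  = trans (cong (x +_) (packedSize-split xs bs)) (sym (+-assoc x _ _))
... | false = trans (cong (x +_) (packedSize-split xs bs))
                    (x∙yz≈y∙xz x (sum (bigItems xs bs)) (nonBigSize xs bs))

small⇒isBig≡false : ∀ {x} → x ≤ ¼ → isBig x ≡ false
small⇒isBig≡false {x} x≤¼ with classify x
... | small _     = refl
... | medium m    = ⊥-elim (small⇒¬medium x≤¼ m)
... | large l     = ⊥-elim (small⇒¬large x≤¼ l)
... | huge _ _    = refl
... | oversized _ = refl

between⇒isBig≡true : ∀ {x} → ¼ < x → x < ¾ → isBig x ≡ true
between⇒isBig≡true {x} ¼<x x<¾ with classify x
... | small x≤¼   = ⊥-elim (<⇒≱ ¼<x x≤¼)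
... | medium _    = refl
... | large _     = refl
... | huge ¾≤x _  = ⊥-elim (<⇒≱ x<¾ ¾≤x)
... | oversized h = ⊥-elim (<⇒≱ x<¾ (<⇒≤ (<-trans ¾<1 h)))

smallTotal-small : ∀ {n} {x} (xs : Vec ℚ n) → x ≤ ¼ → smallTotal (x ∷ xs) ≡ x + smallTotal xs
smallTotal-small {x = x} xs x≤¼ with classify x
... | small _     = refl
... | medium m    = ⊥-elim (small⇒¬medium x≤¼ m)
... | large l     = ⊥-elim (small⇒¬large x≤¼ l)
... | huge ¾≤x _  = ⊥-elim (<⇒≱ ¼<¾ (≤-trans ¾≤x x≤¼))
... | oversized h = ⊥-elim (<⇒≱ (<-trans ¼<1 h) x≤¼)

smallTotal-notSmall : ∀ {n} {x} (xs : Vec ℚ n) → ¼ < x → smallTotal (x ∷ xs) ≡ smallTotal xs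
smallTotal-notSmall {x = x} xs ¼<x with classify x
... | small x≤¼   = ⊥-elim (<⇒≱ ¼<x x≤¼)
... | medium _    = refl
... | large _     = refl
... | huge _ _    = refl
... | oversized _ = refl

nonBigSize-big : ∀ {n} {x} (xs : Vec ℚ n) b bs → isBig x ≡ true →
                 nonBigSize (x ∷ xs) (b ∷ bs) ≡ nonBigSize xs bs
nonBigSize-big xs false bs _ = refl
nonBigSize-big xs true  bs e rewrite e = refl

applyRemoval-[] : ∀ r → applyRemoval r [] ≡ []
applyRemoval-[] keepAll    = refl
applyRemoval-[] dropAll    = refl
applyRemoval-[] (dropAt k) = refl

retained : Removal → ℚ → ∀ {n} → Vec ℚ n → Vec Bool n → Vec Bool n
retained r t xs bs = zipWith _∧_ (retain r t xs bs) bs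

bigItems-retained : ∀ r t {n} (xs : Vec ℚ n) bs →
                    bigItems xs (retained r t xs bs) ≡ applyRemoval r (bigItems xs bs)
bigItems-retained r t []       []           = sym (applyRemoval-[] r)
bigItems-retained r t (x ∷ xs) (false ∷ bs) = bigItems-retained r t xs bs
bigItems-retained r t (x ∷ xs) (true  ∷ bs) with isBig x in big
bigItems-retained keepAll          t (x ∷ xs) (true ∷ bs) | true rewrite big =
  cong (x ∷_) (bigItems-retained keepAll t xs bs)
bigItems-retained dropAll          t (x ∷ xs) (true ∷ bs) | true = bigItems-retained dropAll t xs bs
bigItems-retained (dropAt zero)    t (x ∷ xs) (true ∷ bs) | true = bigItems-retained keepAll t xs bs
bigItems-retained (dropAt (suc k)) t (x ∷ xs) (true ∷ bs) | true rewrite big =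
  cong (x ∷_) (bigItems-retained (dropAt k) t xs bs)
bigItems-retained r t (x ∷ xs) (true ∷ bs) | false with t + x ≤? 1ℚ
... | yes _ rewrite big = bigItems-retained r (t + x) xs bs
... | no _              = bigItems-retained r t xs bs

retained-fits : ∀ r t {n} (xs : Vec ℚ n) bs → t ≤ 1ℚ → t + nonBigSize xs (retained r t xs bs) ≤ 1ℚ
retained-fits r t []       []           t≤1 = subst (_≤ 1ℚ) (sym (+-identityʳ t)) t≤1
retained-fits r t (x ∷ xs) (false ∷ bs) t≤1 = retained-fits r t xs bs t≤1
retained-fits r t (x ∷ xs) (true  ∷ bs) t≤1 with isBig x in big
... | true rewrite nonBigSize-big xs (keepsHead r ∧ true) (retained (tailRemoval r) t xs bs) big =
  retained-fits (tailRemoval r) t xs bs t≤1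
... | false with t + x ≤? 1ℚ
...   | yes t+x≤1 rewrite big = subst (_≤ 1ℚ) (+-assoc t x _) (retained-fits r (t + x) xs bs t+x≤1)
...   | no _ = retained-fits r t xs bs t≤1

NonBigAreSmall : ∀ {n} → Vec ℚ n → Vec Bool n → Set
NonBigAreSmall []       []           = ⊤
NonBigAreSmall (x ∷ xs) (false ∷ bs) = NonBigAreSmall xs bs
NonBigAreSmall (x ∷ xs) (true  ∷ bs) = (isBig x ≡ false → x ≤ ¼) × NonBigAreSmall xs bs

-- An item is only dropped when it does not fit; a small item does not fit only above ¾.
retained-keepsAll⊎>¾ : ∀ r t {n} (xs : Vec ℚ n) bs → NonBigAreSmall xs bs → AllPositive xs →
                        nonBigSize xs (retained r t xs bs) ≡ nonBigSize xs bs ⊎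
                        ¾ < t + nonBigSize xs (retained r t xs bs)
retained-keepsAll⊎>¾ r t []       []           _ _ = inj₁ refl
retained-keepsAll⊎>¾ r t (x ∷ xs) (false ∷ bs) s (_ ∷ ps) = retained-keepsAll⊎>¾ r t xs bs s ps
retained-keepsAll⊎>¾ r t (x ∷ xs) (true  ∷ bs) (sx , s) (_ ∷ ps) with isBig x in big
... | true rewrite nonBigSize-big xs (keepsHead r ∧ true) (retained (tailRemoval r) t xs bs) big =
  retained-keepsAll⊎>¾ (tailRemoval r) t xs bs s ps
... | false with t + x ≤? 1ℚ
...   | yes _ rewrite big with retained-keepsAll⊎>¾ r (t + x) xs bs s ps
...     | inj₁ e = inj₁ (cong (x +_) e)
...     | inj₂ >¾ = inj₂ (subst (¾ <_) (+-assoc t x _) >¾)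
retained-keepsAll⊎>¾ r t (x ∷ xs) (true ∷ bs) (sx , s) (_ ∷ ps) | false | no t+x≰1 =
  inj₂ (<-≤-trans ¾<t (p≤p+q t (nonBigSize-nonNeg _ ps)))
  where
  ¾<t : ¾ < t
  ¾<t = ≰⇒> (λ t≤¾ → t+x≰1 (+-mono-≤ t≤¾ (sx refl)))

below¾⇒nonBigAreSmall : ∀ {n} (xs : Vec ℚ n) bs → AllPositive xs → packedSize xs bs < ¾ →
                        NonBigAreSmall xs bs
below¾⇒nonBigAreSmall []       []           _        _ = tt
below¾⇒nonBigAreSmall (x ∷ xs) (false ∷ bs) (_ ∷ ps) s<¾ = below¾⇒nonBigAreSmall xs bs ps s<¾
below¾⇒nonBigAreSmall (x ∷ xs) (true  ∷ bs) (p ∷ ps) s<¾ =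
  isSmall , below¾⇒nonBigAreSmall xs bs ps (≤-<-trans (p≤q+p (packedSize xs bs) (<⇒≤ p)) s<¾)
  where
  x<¾ : x < ¾
  x<¾ = ≤-<-trans (p≤p+q x (packedSize-nonNeg bs ps)) s<¾
  isSmall : isBig x ≡ false → x ≤ ¼
  isSmall with classify x
  ... | small x≤¼   = λ _ → x≤¼
  ... | medium _    = λ ()
  ... | large _     = λ ()
  ... | huge ¾≤x _  = ⊥-elim (<⇒≱ x<¾ ¾≤x)
  ... | oversized h = ⊥-elim (<⇒≱ x<¾ (<⇒≤ (<-trans ¾<1 h)))

-- Feasibility

frozen-stays : ∀ p {n} (xs : Vec ℚ n) bs x (d : Dec (¾ ≤ packedSize xs bs)) → ¾ ≤ packedSize xs bs →
               ¾ ≤ packedSize (x ∷ xs) (extend (stepBy p xs bs x d) bs)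
frozen-stays p xs bs x (yes _)  ¾≤s rewrite keepOld-∧ bs = ¾≤s
frozen-stays p xs bs x (no ¾≰s) ¾≤s = ⊥-elim (¾≰s ¾≤s)

gain-frozen : ∀ a {n} x (xs : Vec ℚ n) → ¾ ≤ gain algorithm a xs → ¾ ≤ gain algorithm a (x ∷ xs)
gain-frozen a x xs ¾≤g = subst (λ bs → ¾ ≤ packedSize (x ∷ xs) bs) (sym (pack-∷ a x xs))
  (frozen-stays (policyFor a) xs bs x (¾ ≤? packedSize xs bs) ¾≤g)
  where bs = pack algorithm a xs

packedSize-accept : ∀ {n} x (xs : Vec ℚ n) bs r →
                    let t = bigLoad r x (bigItems xs bs) in
                    packedSize (x ∷ xs) (true ∷ retained r t xs bs) ≡
                    t + nonBigSize xs (retained r t xs bs)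
packedSize-accept x xs bs r = begin
  x + packedSize xs cs
    ≡⟨ cong (x +_) (packedSize-split xs cs) ⟩
  x + (sum (bigItems xs cs) + nonBigSize xs cs)
    ≡⟨ cong (λ b → x + (sum b + nonBigSize xs cs)) (bigItems-retained r t xs bs) ⟩
  x + (sum (applyRemoval r (bigItems xs bs)) + nonBigSize xs cs)
    ≡⟨ +-assoc x _ _ ⟨
  t + nonBigSize xs cs ∎
  where
  open ≡-Reasoning
  t  = bigLoad r x (bigItems xs bs)
  cs = retained r t xs bs

acceptWith-fits : ∀ {n} x (xs : Vec ℚ n) bs r (d : Dec (bigLoad r x (bigItems xs bs) ≤ 1ℚ)) →
                  packedSize xs bs ≤ 1ℚ → packedSize (x ∷ xs) (extend (acceptWith xs bs x r d) bs) ≤ 1ℚ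
acceptWith-fits x xs bs r (yes t≤1) _ rewrite packedSize-accept x xs bs r = retained-fits r _ xs bs t≤1
acceptWith-fits x xs bs r (no _)  s≤1 rewrite keepOld-∧ bs = s≤1

perform-fits : ∀ {n} x (xs : Vec ℚ n) bs d →
               packedSize xs bs ≤ 1ℚ → packedSize (x ∷ xs) (extend (perform xs bs x d) bs) ≤ 1ℚ
perform-fits x xs bs reject     s≤1 rewrite keepOld-∧ bs = s≤1
perform-fits x xs bs (accept r) = acceptWith-fits x xs bs r (bigLoad r x (bigItems xs bs) ≤? 1ℚ)

respond-fits : ∀ p {n} x (xs : Vec ℚ n) bs (c : SizeClass x) → packedSize xs bs < ¾ →
               packedSize xs bs ≤ 1ℚ → packedSize (x ∷ xs) (extend (respond p xs bs x c) bs) ≤ 1ℚ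
respond-fits p x xs bs (small x≤¼) s<¾ _ rewrite keepOld-∧ bs =
  ≤-trans (+-mono-≤ x≤¼ (<⇒≤ s<¾)) (toWitness {a? = ¼ + ¾ ≤? 1ℚ} tt)
respond-fits p x xs bs (medium _) _ = perform-fits x xs bs (onMedium p (bigItems xs bs) x)
respond-fits p x xs bs (large _)  _ = perform-fits x xs bs (onLarge p (bigItems xs bs) x)
respond-fits p x xs bs (huge _ x≤1) _ _
  rewrite packedSize-dropAll xs bs = subst (_≤ 1ℚ) (sym (+-identityʳ x)) x≤1
respond-fits p x xs bs (oversized _) _ s≤1 rewrite keepOld-∧ bs = s≤1

stepBy-fits : ∀ p {n} x (xs : Vec ℚ n) bs (d : Dec (¾ ≤ packedSize xs bs)) →
              packedSize xs bs ≤ 1ℚ → packedSize (x ∷ xs) (extend (stepBy p xs bs x d) bs) ≤ 1ℚ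
stepBy-fits p x xs bs (yes _)  s≤1 rewrite keepOld-∧ bs = s≤1
stepBy-fits p x xs bs (no ¾≰s) s≤1 = respond-fits p x xs bs (classify x) (≰⇒> ¾≰s) s≤1

gain≤1 : ∀ a {n} (xs : Vec ℚ n) → gain algorithm a xs ≤ 1ℚ
gain≤1 a []       = toWitness {a? = 0ℚ ≤? 1ℚ} tt
gain≤1 a (x ∷ xs) = subst (λ bs → packedSize (x ∷ xs) bs ≤ 1ℚ) (sym (pack-∷ a x xs))
  (stepBy-fits (policyFor a) x xs bs (¾ ≤? packedSize xs bs) (gain≤1 a xs))
  where bs = pack algorithm a xs

allFit : ∀ a {n} (xs : Vec ℚ n) → AllFit algorithm a xs
allFit a []       = tt
allFit a (x ∷ xs) = gain≤1 a (x ∷ xs) , allFit a xs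

-- Runs that stay below ¾

¬Huge : ℚ → Set
¬Huge x = ¾ ≤ x → ¬ (x ≤ 1ℚ)

<¾⇒¬Huge : ∀ {x} → x < ¾ → ¬Huge x
<¾⇒¬Huge x<¾ ¾≤x _ = <⇒≱ x<¾ ¾≤x

HeldInvariant ItemFact : Set₁
HeldInvariant = ∀ {n} → Vec ℚ n → List ℚ → Set
ItemFact      = ∀ {n} → ℚ → Vec ℚ n → Set

Facts : ItemFact → ∀ {n} → Vec ℚ n → Set
Facts Fact []       = ⊤
Facts Fact (x ∷ xs) = Fact x xs × Facts Fact xs

-- What a decision on the big item x must re-establish, assuming the run stays below ¾.
data Preserved (Inv : HeldInvariant) (Fact : ItemFact) {n} (xs : Vec ℚ n) (held : List ℚ) (x : ℚ) :
               Decision → Set where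
  rejecting : Inv (x ∷ xs) held → Fact x xs → Preserved Inv Fact xs held x reject
  accepting : ∀ {r} →
              (bigLoad r x held ≤ 1ℚ → bigLoad r x held < ¾ →
                 Inv (x ∷ xs) (x ∷ applyRemoval r held) × Fact x xs) →
              (¬ bigLoad r x held ≤ 1ℚ → Inv (x ∷ xs) held × Fact x xs) →
              Preserved Inv Fact xs held x (accept r)

-- Inv relates the history to the big items held; Fact x xs is what an unfrozen run
-- certifies about the item x and the items xs before it.
record RunInvariant (p : Policy) : Set₁ where
  field
    Inv           : HeldInvariant
    Fact          : ItemFact
    inv-[]        : Inv [] []
    inv-small     : ∀ {n} {xs : Vec ℚ n} {held} x → x ≤ ¼ → Inv xs held → Inv (x ∷ xs) held × Fact x xs
    inv-oversized : ∀ {n} {xs : Vec ℚ n} {held} x → 1ℚ < x → Inv xs held → Inv (x ∷ xs) held × Fact x xs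
    inv-medium    : ∀ {n} {xs : Vec ℚ n} {held} x → Medium x → Inv xs held →
                    Preserved Inv Fact xs held x (onMedium p held x)
    inv-large     : ∀ {n} {xs : Vec ℚ n} {held} x → Large x → Inv xs held →
                    Preserved Inv Fact xs held x (onLarge p held x)

Unfrozen : Advice → ∀ {n} → Vec ℚ n → Set
Unfrozen a xs = ¬ (¾ ≤ gain algorithm a xs)

module UnfrozenRun (a : Advice) (I : RunInvariant (policyFor a)) where
  open RunInvariant I

  record Run {n} (xs : Vec ℚ n) : Set where
    field
      invariant : Inv xs (bigItems xs (pack algorithm a xs))
      facts     : Facts Fact xs
      noHuge    : All ¬Huge xs
      smallKept : nonBigSize xs (pack algorithm a xs) ≡ smallTotal xs

  Outcome : ∀ {n} (xs : Vec ℚ n) (x : ℚ) → Vec Bool (suc n) → Set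
  Outcome xs x cs = ¬ (¾ ≤ packedSize (x ∷ xs) cs) →
    Inv (x ∷ xs) (bigItems (x ∷ xs) cs) × Fact x xs × ¬Huge x ×
    nonBigSize (x ∷ xs) cs ≡ smallTotal (x ∷ xs)

  acceptWith-outcome : ∀ {n} x (xs : Vec ℚ n) bs r (d : Dec (bigLoad r x (bigItems xs bs) ≤ 1ℚ)) →
    ¼ < x → x < ¾ → AllPositive xs → packedSize xs bs < ¾ → nonBigSize xs bs ≡ smallTotal xs →
    Preserved Inv Fact xs (bigItems xs bs) x (accept r) →
    Outcome xs x (extend (acceptWith xs bs x r d) bs)
  acceptWith-outcome x xs bs r (no ¬fits) ¼<x x<¾ _ _ kept (accepting _ rejected)
    rewrite keepOld-∧ bs = λ _ →
    proj₁ (rejected ¬fits) , proj₂ (rejected ¬fits) , <¾⇒¬Huge x<¾ ,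
    trans kept (sym (smallTotal-notSmall xs ¼<x))
  acceptWith-outcome x xs bs r (yes fits) ¼<x x<¾ ps s<¾ kept (accepting accepted _) unfrozen =
    subst (Inv (x ∷ xs)) (sym held≡) (proj₁ next) , proj₂ next , <¾⇒¬Huge x<¾ , kept′
    where
    t  = bigLoad r x (bigItems xs bs)
    cs = retained r t xs bs
    isBig-x : isBig x ≡ true
    isBig-x = between⇒isBig≡true ¼<x x<¾
    t+rest<¾ : t + nonBigSize xs cs < ¾
    t+rest<¾ = subst (_< ¾) (packedSize-accept x xs bs r) (≰⇒> unfrozen)
    next = accepted fits (≤-<-trans (p≤p+q t (nonBigSize-nonNeg cs ps)) t+rest<¾)
    held≡ : bigItems (x ∷ xs) (true ∷ cs) ≡ x ∷ applyRemoval r (bigItems xs bs)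
    held≡ rewrite isBig-x = cong (x ∷_) (bigItems-retained r t xs bs)
    nothingDropped : nonBigSize xs cs ≡ nonBigSize xs bs
    nothingDropped with retained-keepsAll⊎>¾ r t xs bs (below¾⇒nonBigAreSmall xs bs ps s<¾) ps
    ... | inj₁ same = same
    ... | inj₂ >¾   = ⊥-elim (<⇒≱ >¾ (<⇒≤ t+rest<¾))
    kept′ : nonBigSize (x ∷ xs) (true ∷ cs) ≡ smallTotal (x ∷ xs)
    kept′ = begin
      nonBigSize (x ∷ xs) (true ∷ cs) ≡⟨ nonBigSize-big xs true cs isBig-x ⟩
      nonBigSize xs cs                ≡⟨ nothingDropped ⟩
      nonBigSize xs bs                ≡⟨ kept ⟩
      smallTotal xs                   ≡⟨ smallTotal-notSmall xs ¼<x ⟨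
      smallTotal (x ∷ xs)             ∎
      where open ≡-Reasoning

  perform-outcome : ∀ {n} x (xs : Vec ℚ n) bs d →
    ¼ < x → x < ¾ → AllPositive xs → packedSize xs bs < ¾ → nonBigSize xs bs ≡ smallTotal xs →
    Preserved Inv Fact xs (bigItems xs bs) x d → Outcome xs x (extend (perform xs bs x d) bs)
  perform-outcome x xs bs reject ¼<x x<¾ _ _ kept (rejecting inv fact) rewrite keepOld-∧ bs = λ _ →
    inv , fact , <¾⇒¬Huge x<¾ , trans kept (sym (smallTotal-notSmall xs ¼<x))
  perform-outcome x xs bs (accept r) =
    acceptWith-outcome x xs bs r (bigLoad r x (bigItems xs bs) ≤? 1ℚ)

  respond-outcome : ∀ {n} x (xs : Vec ℚ n) bs (c : SizeClass x) → AllPositive xs →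
    packedSize xs bs < ¾ → Inv xs (bigItems xs bs) → nonBigSize xs bs ≡ smallTotal xs →
    Outcome xs x (extend (respond (policyFor a) xs bs x c) bs)
  respond-outcome x xs bs (small x≤¼) _ _ inv kept rewrite keepOld-∧ bs = λ _ →
    subst (Inv (x ∷ xs)) (sym held≡) (proj₁ (inv-small x x≤¼ inv)) , proj₂ (inv-small x x≤¼ inv) ,
    <¾⇒¬Huge (≤-<-trans x≤¼ ¼<¾) , kept′
    where
    held≡ : bigItems (x ∷ xs) (true ∷ bs) ≡ bigItems xs bs
    held≡ rewrite small⇒isBig≡false x≤¼ = refl
    kept′ : nonBigSize (x ∷ xs) (true ∷ bs) ≡ smallTotal (x ∷ xs)
    kept′ rewrite small⇒isBig≡false x≤¼ = trans (cong (x +_) kept) (sym (smallTotal-small xs x≤¼))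
  respond-outcome x xs bs (medium m@(¼<x , x≤½)) ps s<¾ inv kept =
    perform-outcome x xs bs (onMedium (policyFor a) (bigItems xs bs) x) ¼<x (≤-<-trans x≤½ ½<¾)
      ps s<¾ kept (inv-medium x m inv)
  respond-outcome x xs bs (large l@(½<x , x<¾)) ps s<¾ inv kept =
    perform-outcome x xs bs (onLarge (policyFor a) (bigItems xs bs) x) (<-trans ¼<½ ½<x) x<¾
      ps s<¾ kept (inv-large x l inv)
  respond-outcome x xs bs (huge ¾≤x _) _ _ _ _ unfrozen rewrite packedSize-dropAll xs bs =
    ⊥-elim (unfrozen (subst (¾ ≤_) (sym (+-identityʳ x)) ¾≤x))
  respond-outcome x xs bs (oversized 1<x) _ _ inv kept rewrite keepOld-∧ bs = λ _ →
    proj₁ (inv-oversized x 1<x inv) , proj₂ (inv-oversized x 1<x inv) , (λ _ x≤1 → <⇒≱ 1<x x≤1) ,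
    trans kept (sym (smallTotal-notSmall xs (<-trans ¼<1 1<x)))

  stepBy-outcome : ∀ {n} x (xs : Vec ℚ n) bs (d : Dec (¾ ≤ packedSize xs bs)) → AllPositive xs →
    Inv xs (bigItems xs bs) → nonBigSize xs bs ≡ smallTotal xs →
    Outcome xs x (extend (stepBy (policyFor a) xs bs x d) bs)
  stepBy-outcome x xs bs d@(yes frozen) _ _ _ unfrozen =
    ⊥-elim (unfrozen (frozen-stays (policyFor a) xs bs x d frozen))
  stepBy-outcome x xs bs (no ¾≰s) ps = respond-outcome x xs bs (classify x) ps (≰⇒> ¾≰s)

  run : ∀ {n} (xs : Vec ℚ n) → AllPositive xs → Unfrozen a xs → Run xs
  run [] _ _ = record { invariant = inv-[] ; facts = tt ; noHuge = [] ; smallKept = refl }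
  run (x ∷ xs) (_ ∷ ps) unfrozen =
    let open Run (run xs ps (λ frozen → unfrozen (gain-frozen a x xs frozen)))
        bs = pack algorithm a xs
        (inv , fact , ¬huge , kept) = subst (Outcome xs x) (sym (pack-∷ a x xs))
          (stepBy-outcome x xs bs (¾ ≤? packedSize xs bs) ps invariant smallKept) unfrozen
    in record { invariant = inv ; facts = fact , facts ; noHuge = ¬huge ∷ noHuge ; smallKept = kept }

-- Invariants of the four policies

x+[h]≡x+h : ∀ x h → x + sum (h ∷ []) ≡ x + h
x+[h]≡x+h x h = cong (x +_) (sum-[y] h)

x+[h₁,h₂]≡x+⟨h₁+h₂⟩ : ∀ x h₁ h₂ → x + sum (h₁ ∷ h₂ ∷ []) ≡ x + (h₁ + h₂)
x+[h₁,h₂]≡x+⟨h₁+h₂⟩ x h₁ h₂ = cong (x +_) (sum-[y,z] h₁ h₂)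

h+x≡x+[h] : ∀ h x → h + x ≡ x + sum (h ∷ [])
h+x≡x+[h] h x = trans (+-comm h x) (sym (x+[h]≡x+h x h))

alone-fits : ∀ {x} → x < ¾ → x + sum [] ≤ 1ℚ
alone-fits {x} x<¾ = subst (_≤ 1ℚ) (sym (+-identityʳ x)) (<⇒≤ (<-trans x<¾ ¾<1))

medium-fits : ∀ {x} → Medium x → x + sum [] ≤ 1ℚ
medium-fits (_ , x≤½) = alone-fits (≤-<-trans x≤½ ½<¾)

medium+medium-fits : ∀ {x h} → Medium x → Medium h → x + sum (h ∷ []) ≤ 1ℚ
medium+medium-fits {x} {h} (_ , x≤½) (_ , h≤½) = subst (_≤ 1ℚ) (sym (x+[h]≡x+h x h)) (+-mono-≤ x≤½ h≤½)

medium+large>¾ : ∀ {x h} → ¼ < x → ½ < h → ¾ < x + sum (h ∷ [])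
medium+large>¾ {x} {h} ¼<x ½<h = subst (¾ <_) (sym (x+[h]≡x+h x h)) (+-mono-< ¼<x ½<h)

large+medium>¾ : ∀ {x h} → ½ < x → ¼ < h → ¾ < x + sum (h ∷ [])
large+medium>¾ {x} {h} ½<x ¼<h = subst (¾ <_) (sym (x+[h]≡x+h x h)) (+-mono-< ½<x ¼<h)

1<h+x⇒1<x+y : ∀ {h x y} → h ≤ y → 1ℚ < h + x → 1ℚ < x + y
1<h+x⇒1<x+y {h} {x} {y} h≤y 1<h+x = <-≤-trans 1<h+x (subst (h + x ≤_) (+-comm y x) (+-monoˡ-≤ x h≤y))

h+x<¾⇒x+y<¾ : ∀ {h x y} → y ≤ h → h + x < ¾ → x + y < ¾
h+x<¾⇒x+y<¾ {h} {x} {y} y≤h h+x<¾ = ≤-<-trans (subst (x + y ≤_) (+-comm x h) (+-monoʳ-≤ x y≤h)) h+x<¾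

freezes : ∀ {Inv : HeldInvariant} {Fact : ItemFact} {n} {xs : Vec ℚ n} {held x} r →
          ¾ ≤ bigLoad r x held → bigLoad r x held ≤ 1ℚ → Preserved Inv Fact xs held x (accept r)
freezes r ¾≤t t≤1 = accepting (λ _ t<¾ → ⊥-elim (<⇒≱ t<¾ ¾≤t)) (λ t≰1 → ⊥-elim (t≰1 t≤1))

accepting-fits : ∀ {Inv : HeldInvariant} {Fact : ItemFact} {n} {xs : Vec ℚ n} {held x} r →
           bigLoad r x held ≤ 1ℚ → Inv (x ∷ xs) (x ∷ applyRemoval r held) × Fact x xs →
           Preserved Inv Fact xs held x (accept r)
accepting-fits r t≤1 next = accepting (λ _ _ → next) (λ t≰1 → ⊥-elim (t≰1 t≤1))

data SmallestLargeInv {n} (xs : Vec ℚ n) : List ℚ → Set where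
  noLarge  : All (λ y → ¬ Large y) xs → SmallestLargeInv xs []
  smallest : ∀ {h} → Large h → All (λ y → Large y → h ≤ y) xs → SmallestLargeInv xs (h ∷ [])

MediumMissesLarge : ∀ {n} → ℚ → Vec ℚ n → Set
MediumMissesLarge x xs = All (λ y → Medium x → Large y → 1ℚ < x + y) xs

smallestLargeInv-skip : ∀ {n} {xs : Vec ℚ n} {held} x → ¬ Large x →
                        SmallestLargeInv xs held → SmallestLargeInv (x ∷ xs) held
smallestLargeInv-skip x ¬l (noLarge a)    = noLarge (¬l ∷ a)
smallestLargeInv-skip x ¬l (smallest l a) = smallest l ((λ l′ → ⊥-elim (¬l l′)) ∷ a)

¬medium⇒MediumMissesLarge : ∀ {n} (xs : Vec ℚ n) {x} → ¬ Medium x → MediumMissesLarge x xs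
¬medium⇒MediumMissesLarge xs ¬m = All.universal (λ _ m _ → ⊥-elim (¬m m)) xs

smallestLargeInv : RunInvariant smallestLarge
smallestLargeInv = record
  { Inv           = SmallestLargeInv
  ; Fact          = MediumMissesLarge
  ; inv-[]        = noLarge []
  ; inv-small     = λ {_} {xs} x x≤¼ inv →
      smallestLargeInv-skip x (small⇒¬large x≤¼) inv ,
      ¬medium⇒MediumMissesLarge xs (small⇒¬medium x≤¼)
  ; inv-oversized = λ {_} {xs} x 1<x inv →
      smallestLargeInv-skip x (oversized⇒¬large 1<x) inv ,
      ¬medium⇒MediumMissesLarge xs (oversized⇒¬medium 1<x)
  ; inv-medium    = onMedium-preserves
  ; inv-large     = onLarge-preserves
  }
  where
  Preserved₁ : ∀ {n} → Vec ℚ n → List ℚ → ℚ → Decision → Set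
  Preserved₁ = Preserved SmallestLargeInv MediumMissesLarge

  onMedium-preserves : ∀ {n} {xs : Vec ℚ n} {held} x → Medium x → SmallestLargeInv xs held →
                       Preserved₁ xs held x (onMedium smallestLarge held x)
  onMedium-preserves x m (noLarge a) =
    rejecting (smallestLargeInv-skip x (medium⇒¬large m) (noLarge a)) (All.map (λ ¬l _ l → ⊥-elim (¬l l)) a)
  onMedium-preserves x m@(¼<x , _) (smallest {h} l@(½<h , _) a) with h + x ≤? 1ℚ
  ... | yes h+x≤1 = freezes keepAll (<⇒≤ (medium+large>¾ ¼<x ½<h)) (subst (_≤ 1ℚ) (h+x≡x+[h] h x) h+x≤1)
  ... | no h+x≰1  = rejecting (smallestLargeInv-skip x (medium⇒¬large m) (smallest l a))
                              (All.map (λ h≤y _ ly → 1<h+x⇒1<x+y (h≤y ly) (≰⇒> h+x≰1)) a)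

  onLarge-preserves : ∀ {n} {xs : Vec ℚ n} {held} x → Large x → SmallestLargeInv xs held →
                      Preserved₁ xs held x (onLarge smallestLarge held x)
  onLarge-preserves {xs = xs} x l@(_ , x<¾) (noLarge a) =
    accepting-fits keepAll (alone-fits x<¾)
      (smallest l ((λ _ → ≤-refl) ∷ All.map (λ ¬l l′ → ⊥-elim (¬l l′)) a) ,
       ¬medium⇒MediumMissesLarge xs (λ m → medium⇒¬large m l))
  onLarge-preserves {xs = xs} x l@(_ , x<¾) (smallest {h} lh a) with x <? h
  ... | yes x<h = accepting-fits dropAll (alone-fits x<¾)
                    (smallest l ((λ _ → ≤-refl) ∷ All.map (λ h≤y l′ → ≤-trans (<⇒≤ x<h) (h≤y l′)) a) ,
                     ¬medium⇒MediumMissesLarge xs (λ m → medium⇒¬large m l))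
  ... | no x≮h  = rejecting (smallest lh ((λ _ → ≮⇒≥ x≮h) ∷ a))
                            (¬medium⇒MediumMissesLarge xs (λ m → medium⇒¬large m l))

data LargestMediumInv {n} (xs : Vec ℚ n) : List ℚ → Set where
  noMedium : All (λ y → ¬ Medium y) xs → LargestMediumInv xs []
  largest  : ∀ {h} → Medium h → All (λ y → Medium y → y ≤ h) xs → LargestMediumInv xs (h ∷ [])

MediumPairsBelow¾ : ∀ {n} → ℚ → Vec ℚ n → Set
MediumPairsBelow¾ x xs = All (λ y → Medium x → Medium y → x + y < ¾) xs

largestMediumInv-skip : ∀ {n} {xs : Vec ℚ n} {held} x → ¬ Medium x →
                        LargestMediumInv xs held → LargestMediumInv (x ∷ xs) held
largestMediumInv-skip x ¬m (noMedium a)  = noMedium (¬m ∷ a)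
largestMediumInv-skip x ¬m (largest m a) = largest m ((λ m′ → ⊥-elim (¬m m′)) ∷ a)

¬medium⇒MediumPairsBelow¾ : ∀ {n} (xs : Vec ℚ n) {x} → ¬ Medium x → MediumPairsBelow¾ x xs
¬medium⇒MediumPairsBelow¾ xs ¬m = All.universal (λ _ m _ → ⊥-elim (¬m m)) xs

largestMediumInv : RunInvariant largestMedium
largestMediumInv = record
  { Inv           = LargestMediumInv
  ; Fact          = MediumPairsBelow¾
  ; inv-[]        = noMedium []
  ; inv-small     = λ {_} {xs} x x≤¼ inv →
      largestMediumInv-skip x (small⇒¬medium x≤¼) inv ,
      ¬medium⇒MediumPairsBelow¾ xs (small⇒¬medium x≤¼)
  ; inv-oversized = λ {_} {xs} x 1<x inv →
      largestMediumInv-skip x (oversized⇒¬medium 1<x) inv ,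
      ¬medium⇒MediumPairsBelow¾ xs (oversized⇒¬medium 1<x)
  ; inv-medium    = onMedium-preserves
  ; inv-large     = λ {_} {xs} x l inv → rejecting (largestMediumInv-skip x (λ m → medium⇒¬large m l) inv)
                                                   (¬medium⇒MediumPairsBelow¾ xs (λ m → medium⇒¬large m l))
  }
  where
  onMedium-preserves : ∀ {n} {xs : Vec ℚ n} {held} x → Medium x → LargestMediumInv xs held →
                       Preserved LargestMediumInv MediumPairsBelow¾ xs held x
                         (onMedium largestMedium held x)
  onMedium-preserves x m (noMedium a) =
    accepting-fits keepAll (medium-fits m)
      (largest m ((λ _ → ≤-refl) ∷ All.map (λ ¬m m′ → ⊥-elim (¬m m′)) a) ,
       All.map (λ ¬m _ m′ → ⊥-elim (¬m m′)) a)
  onMedium-preserves x m (largest {h} mh a) with ¾ ≤? h + x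
  ... | yes ¾≤h+x = freezes keepAll (subst (¾ ≤_) (h+x≡x+[h] h x) ¾≤h+x) (medium+medium-fits m mh)
  ... | no ¾≰h+x with h <? x
  ...   | yes h<x = accepting-fits dropAll (medium-fits m)
                      (largest m ((λ _ → ≤-refl) ∷ All.map (λ y≤h m′ → ≤-trans (y≤h m′) (<⇒≤ h<x)) a) ,
                       All.map (λ y≤h _ m′ → h+x<¾⇒x+y<¾ (y≤h m′) (≰⇒> ¾≰h+x)) a)
  ...   | no h≮x  = rejecting (largest mh ((λ _ → ≮⇒≥ h≮x) ∷ a))
                              (All.map (λ y≤h _ m′ → h+x<¾⇒x+y<¾ (y≤h m′) (≰⇒> ¾≰h+x)) a)

allPairs-universal : ∀ {R : ℚ → ℚ → Set} → (∀ a b → R a b) → ∀ {n} (xs : Vec ℚ n) → AllPairs R xs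
allPairs-universal r []       = []
allPairs-universal r (x ∷ xs) = All.universal (r x) xs ∷ allPairs-universal r xs

allPairs-fromAll : ∀ {S : ℚ → Set} {R : ℚ → ℚ → Set} {n} {xs : Vec ℚ n} →
                   (∀ {a} b → S a → R a b) → All S xs → AllPairs R xs
allPairs-fromAll f []                    = []
allPairs-fromAll {xs = x ∷ xs} f (s ∷ ss) = All.universal (λ b → f b s) xs ∷ allPairs-fromAll f ss

≥min : ∀ {a b y} → a ≤ b → a ≤ y ⊎ b ≤ y → a ≤ y
≥min a≤b (inj₁ a≤y) = a≤y
≥min a≤b (inj₂ b≤y) = ≤-trans a≤b b≤y

≤max : ∀ {a b y} → a ≤ b → y ≤ a ⊎ y ≤ b → y ≤ b
≤max a≤b (inj₁ y≤a) = ≤-trans y≤a a≤b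
≤max a≤b (inj₂ y≤b) = y≤b

data TwoSmallestMediumInv {n} (xs : Vec ℚ n) : List ℚ → Set where
  noMedium     : All (λ y → ¬ Medium y) xs → TwoSmallestMediumInv xs []
  onlyMedium   : ∀ {h} → Medium h → All (λ y → Medium y → h ≤ y) xs →
                 AllPairs (λ y z → Medium y → ¬ Medium z) xs → TwoSmallestMediumInv xs (h ∷ [])
  smallestPair : ∀ {h₁ h₂} → Medium h₁ → Medium h₂ → All (λ y → Medium y → h₁ ≤ y ⊎ h₂ ≤ y) xs →
                 AllPairs (λ y z → Medium y → Medium z → h₁ + h₂ ≤ y + z) xs →
                 TwoSmallestMediumInv xs (h₁ ∷ h₂ ∷ [])

OverflowsWithMediums : ∀ {n} → ℚ → Vec ℚ n → Set
OverflowsWithMediums x xs =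
  All (λ y → Large x → Medium y → 1ℚ < x + y) xs ×
  AllPairs (λ y z → Medium x → Medium y → Medium z → 1ℚ < x + (y + z)) xs

twoSmallestMediumInv-skip : ∀ {n} {xs : Vec ℚ n} {held} x → ¬ Medium x →
                            TwoSmallestMediumInv xs held → TwoSmallestMediumInv (x ∷ xs) held
twoSmallestMediumInv-skip x ¬m (noMedium a) = noMedium (¬m ∷ a)
twoSmallestMediumInv-skip {xs = xs} x ¬m (onlyMedium m a ps) =
  onlyMedium m ((λ m′ → ⊥-elim (¬m m′)) ∷ a) (All.universal (λ _ m′ _ → ¬m m′) xs ∷ ps)
twoSmallestMediumInv-skip {xs = xs} x ¬m (smallestPair m₁ m₂ a ps) =
  smallestPair m₁ m₂ ((λ m′ → ⊥-elim (¬m m′)) ∷ a) (All.universal (λ _ m′ _ → ⊥-elim (¬m m′)) xs ∷ ps)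

¬big⇒OverflowsWithMediums : ∀ {n} (xs : Vec ℚ n) {x} → ¬ Medium x → ¬ Large x → OverflowsWithMediums x xs
¬big⇒OverflowsWithMediums xs ¬m ¬l =
  All.universal (λ _ l _ → ⊥-elim (¬l l)) xs , allPairs-universal (λ _ _ m _ _ → ⊥-elim (¬m m)) xs

medium⇒OverflowsWithMediums : ∀ {n} {xs : Vec ℚ n} {x} → Medium x →
  AllPairs (λ y z → Medium y → Medium z → 1ℚ < x + (y + z)) xs → OverflowsWithMediums x xs
medium⇒OverflowsWithMediums {xs = xs} m ps =
  All.universal (λ _ l _ → ⊥-elim (medium⇒¬large m l)) xs , AllPairs.map (λ f _ → f) ps

large⇒OverflowsWithMediums : ∀ {n} {xs : Vec ℚ n} {x} → Large x →
  All (λ y → Medium y → 1ℚ < x + y) xs → OverflowsWithMediums x xs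
large⇒OverflowsWithMediums {xs = xs} l a =
  All.map (λ f _ → f) a , allPairs-universal (λ _ _ m _ _ → ⊥-elim (medium⇒¬large m l)) xs

three-mediums>¾ : ∀ {x h₁ h₂} → ¼ < x → ¼ < h₁ → ¼ < h₂ → ¾ < x + sum (h₁ ∷ h₂ ∷ [])
three-mediums>¾ {x} {h₁} {h₂} ¼<x ¼<h₁ ¼<h₂ =
  subst (¾ <_) (sym (x+[h₁,h₂]≡x+⟨h₁+h₂⟩ x h₁ h₂)) (+-mono-< ¼<x (+-mono-< ¼<h₁ ¼<h₂))

twoSmallestMediumInv : RunInvariant twoSmallestMedium
twoSmallestMediumInv = record
  { Inv           = TwoSmallestMediumInv
  ; Fact          = OverflowsWithMediums
  ; inv-[]        = noMedium []
  ; inv-small     = λ {_} {xs} x x≤¼ inv → twoSmallestMediumInv-skip x (small⇒¬medium x≤¼) inv ,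
                      ¬big⇒OverflowsWithMediums xs (small⇒¬medium x≤¼) (small⇒¬large x≤¼)
  ; inv-oversized = λ {_} {xs} x 1<x inv → twoSmallestMediumInv-skip x (oversized⇒¬medium 1<x) inv ,
                      ¬big⇒OverflowsWithMediums xs (oversized⇒¬medium 1<x) (oversized⇒¬large 1<x)
  ; inv-medium    = onMedium-preserves
  ; inv-large     = onLarge-preserves
  }
  where
  Preserved₂ : ∀ {n} → Vec ℚ n → List ℚ → ℚ → Decision → Set
  Preserved₂ = Preserved TwoSmallestMediumInv OverflowsWithMediums

  overflows-pair : ∀ {n} {xs : Vec ℚ n} x h₁ h₂ → Medium x →
                   AllPairs (λ y z → Medium y → Medium z → h₁ + h₂ ≤ y + z) xs →
                   ¬ (x + sum (h₁ ∷ h₂ ∷ []) ≤ 1ℚ) → OverflowsWithMediums x xs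
  overflows-pair x h₁ h₂ m ps ¬fits =
    medium⇒OverflowsWithMediums m
      (AllPairs.map (λ f my mz → <-≤-trans 1<x+h₁+h₂ (+-monoʳ-≤ x (f my mz))) ps)
    where
    1<x+h₁+h₂ : 1ℚ < x + (h₁ + h₂)
    1<x+h₁+h₂ = subst (1ℚ <_) (x+[h₁,h₂]≡x+⟨h₁+h₂⟩ x h₁ h₂) (≰⇒> ¬fits)

  onMedium-pair : ∀ {n} {xs : Vec ℚ n} {h₁ h₂} x → Medium x → TwoSmallestMediumInv xs (h₁ ∷ h₂ ∷ []) →
                  Preserved₂ xs (h₁ ∷ h₂ ∷ []) x (onMedium twoSmallestMedium (h₁ ∷ h₂ ∷ []) x)
  onMedium-pair {h₁ = h₁} {h₂} x m@(¼<x , _) (smallestPair m₁ m₂ a ps) with x + sum (h₁ ∷ h₂ ∷ []) ≤? 1ℚ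
  ... | yes fits = freezes keepAll (<⇒≤ (three-mediums>¾ ¼<x (proj₁ m₁) (proj₁ m₂))) fits
  ... | no ¬fits with h₁ ≤? h₂
  ...   | yes h₁≤h₂ with x <? h₂
  ...     | yes x<h₂ = accepting-fits (dropAt 1) (medium+medium-fits m m₁)
                         (smallestPair m m₁
                           ((λ _ → inj₁ ≤-refl) ∷ All.map (λ f m′ → inj₂ (≥min h₁≤h₂ (f m′))) a)
                           (All.map (λ f _ m′ → +-monoʳ-≤ x (≥min h₁≤h₂ (f m′))) a ∷
                            AllPairs.map (λ f my mz → ≤-trans x+h₁≤h₁+h₂ (f my mz)) ps) ,
                          overflows-pair x h₁ h₂ m ps ¬fits)
    where
    x+h₁≤h₁+h₂ : x + h₁ ≤ h₁ + h₂
    x+h₁≤h₁+h₂ = subst (x + h₁ ≤_) (+-comm h₂ h₁) (+-monoˡ-≤ h₁ (<⇒≤ x<h₂))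
  ...     | no x≮h₂  = rejecting
                         (smallestPair m₁ m₂ ((λ _ → inj₁ (≤-trans h₁≤h₂ (≮⇒≥ x≮h₂))) ∷ a)
                           (All.map (λ f _ m′ → subst (h₁ + h₂ ≤_) (+-comm _ x)
                                                  (+-mono-≤ (≥min h₁≤h₂ (f m′)) (≮⇒≥ x≮h₂))) a ∷ ps))
                         (overflows-pair x h₁ h₂ m ps ¬fits)
  onMedium-pair {h₁ = h₁} {h₂} x m (smallestPair m₁ m₂ a ps) | no ¬fits | no h₁≰h₂ with x <? h₁
  ...     | yes x<h₁ = accepting-fits (dropAt 0) (medium+medium-fits m m₂)
                         (smallestPair m m₂
                           ((λ _ → inj₁ ≤-refl) ∷ All.map (λ f m′ → inj₂ (≥min h₂≤h₁ (swap (f m′)))) a)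
                           (All.map (λ f _ m′ → +-monoʳ-≤ x (≥min h₂≤h₁ (swap (f m′)))) a ∷
                            AllPairs.map (λ f my mz → ≤-trans (+-monoˡ-≤ h₂ (<⇒≤ x<h₁)) (f my mz)) ps) ,
                          overflows-pair x h₁ h₂ m ps ¬fits)
    where
    h₂≤h₁ : h₂ ≤ h₁
    h₂≤h₁ = <⇒≤ (≰⇒> h₁≰h₂)
  ...     | no x≮h₁  = rejecting
                         (smallestPair m₁ m₂ ((λ _ → inj₁ (≮⇒≥ x≮h₁)) ∷ a)
                           (All.map (λ f _ m′ → +-mono-≤ (≮⇒≥ x≮h₁) (≥min (<⇒≤ (≰⇒> h₁≰h₂)) (swap (f m′)))) a
                            ∷ ps))
                         (overflows-pair x h₁ h₂ m ps ¬fits)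

  onMedium-preserves : ∀ {n} {xs : Vec ℚ n} {held} x → Medium x → TwoSmallestMediumInv xs held →
                       Preserved₂ xs held x (onMedium twoSmallestMedium held x)
  onMedium-preserves x m (noMedium a) =
    accepting-fits keepAll (medium-fits m)
      (onlyMedium m ((λ _ → ≤-refl) ∷ All.map (λ ¬m m′ → ⊥-elim (¬m m′)) a)
         (All.map (λ ¬m _ m′ → ¬m m′) a ∷ allPairs-fromAll (λ _ ¬m m′ _ → ¬m m′) a) ,
       medium⇒OverflowsWithMediums m (allPairs-fromAll (λ _ ¬m my _ → ⊥-elim (¬m my)) a))
  onMedium-preserves x m (onlyMedium mh a ps) =
    accepting-fits keepAll (medium+medium-fits m mh)
      (smallestPair m mh ((λ _ → inj₁ ≤-refl) ∷ All.map (λ f m′ → inj₂ (f m′)) a)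
         (All.map (λ f _ m′ → +-monoʳ-≤ x (f m′)) a ∷ AllPairs.map (λ f my mz → ⊥-elim (f my mz)) ps) ,
       medium⇒OverflowsWithMediums m (AllPairs.map (λ f my mz → ⊥-elim (f my mz)) ps))
  onMedium-preserves x m inv@(smallestPair _ _ _ _) = onMedium-pair x m inv

  onLarge-preserves : ∀ {n} {xs : Vec ℚ n} {held} x → Large x → TwoSmallestMediumInv xs held →
                      Preserved₂ xs held x (onLarge twoSmallestMedium held x)
  onLarge-preserves x l inv@(noMedium a) =
    rejecting (twoSmallestMediumInv-skip x (λ m → medium⇒¬large m l) inv)
              (large⇒OverflowsWithMediums l (All.map (λ ¬m m → ⊥-elim (¬m m)) a))
  onLarge-preserves x l@(½<x , _) inv@(onlyMedium {h} mh a _) with h + x ≤? 1ℚ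
  ... | yes h+x≤1 =
    freezes keepAll (<⇒≤ (large+medium>¾ ½<x (proj₁ mh))) (subst (_≤ 1ℚ) (h+x≡x+[h] h x) h+x≤1)
  ... | no h+x≰1  = rejecting (twoSmallestMediumInv-skip x (λ m → medium⇒¬large m l) inv)
                      (large⇒OverflowsWithMediums l
                        (All.map (λ h≤y m′ → 1<h+x⇒1<x+y (h≤y m′) (≰⇒> h+x≰1)) a))
  onLarge-preserves x l@(½<x , _) inv@(smallestPair {h₁} {h₂} m₁ m₂ a _) with h₁ ≤? h₂
  ... | yes h₁≤h₂ with h₁ + x ≤? 1ℚ
  ...   | yes h₁+x≤1 =
    freezes (dropAt 1) (<⇒≤ (large+medium>¾ ½<x (proj₁ m₁))) (subst (_≤ 1ℚ) (h+x≡x+[h] h₁ x) h₁+x≤1)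
  ...   | no h₁+x≰1  = rejecting (twoSmallestMediumInv-skip x (λ m → medium⇒¬large m l) inv)
                         (large⇒OverflowsWithMediums l
                           (All.map (λ f m′ → 1<h+x⇒1<x+y (≥min h₁≤h₂ (f m′)) (≰⇒> h₁+x≰1)) a))
  onLarge-preserves x l@(½<x , _) inv@(smallestPair {h₁} {h₂} m₁ m₂ a _) | no h₁≰h₂ with h₂ + x ≤? 1ℚ
  ...   | yes h₂+x≤1 =
    freezes (dropAt 0) (<⇒≤ (large+medium>¾ ½<x (proj₁ m₂))) (subst (_≤ 1ℚ) (h+x≡x+[h] h₂ x) h₂+x≤1)
  ...   | no h₂+x≰1  = rejecting (twoSmallestMediumInv-skip x (λ m → medium⇒¬large m l) inv)
                         (large⇒OverflowsWithMediums l
                           (All.map (λ f m′ → 1<h+x⇒1<x+y (≥min (<⇒≤ (≰⇒> h₁≰h₂)) (swap (f m′)))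
                                                           (≰⇒> h₂+x≰1)) a))

data LargestBigInv {n} (xs : Vec ℚ n) : List ℚ → Set where
  noBig        : All (λ y → ¬ Medium y) xs → All (λ y → ¬ Large y) xs → LargestBigInv xs []
  soleMedium   : ∀ {h} → Medium h → All (λ y → ¬ Large y) xs → All (λ y → Medium y → y ≤ h) xs →
                 AllPairs (λ y z → Medium y → ¬ Medium z) xs → LargestBigInv xs (h ∷ [])
  largestPair  : ∀ {h₁ h₂} → Medium h₁ → Medium h₂ → All (λ y → ¬ Large y) xs →
                 All (λ y → Medium y → y ≤ h₁ ⊎ y ≤ h₂) xs →
                 AllPairs (λ y z → Medium y → Medium z → y + z ≤ h₁ + h₂) xs →
                 LargestBigInv xs (h₁ ∷ h₂ ∷ [])
  largestLarge : ∀ {h} → Large h → All (λ y → Large y → y ≤ h) xs → Any (λ y → Large y × y ≤ h) xs →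
                 LargestBigInv xs (h ∷ [])

NoFact : ∀ {n} → ℚ → Vec ℚ n → Set
NoFact _ _ = ⊤

largestBigInv-skip : ∀ {n} {xs : Vec ℚ n} {held} x → ¬ Medium x → ¬ Large x →
                     LargestBigInv xs held → LargestBigInv (x ∷ xs) held
largestBigInv-skip x ¬m ¬l (noBig a b) = noBig (¬m ∷ a) (¬l ∷ b)
largestBigInv-skip {xs = xs} x ¬m ¬l (soleMedium m b a ps) =
  soleMedium m (¬l ∷ b) ((λ m′ → ⊥-elim (¬m m′)) ∷ a) (All.universal (λ _ m′ _ → ¬m m′) xs ∷ ps)
largestBigInv-skip {xs = xs} x ¬m ¬l (largestPair m₁ m₂ b a ps) =
  largestPair m₁ m₂ (¬l ∷ b) ((λ m′ → ⊥-elim (¬m m′)) ∷ a)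
    (All.universal (λ _ m′ _ → ⊥-elim (¬m m′)) xs ∷ ps)
largestBigInv-skip x ¬m ¬l (largestLarge l a e) = largestLarge l ((λ l′ → ⊥-elim (¬l l′)) ∷ a) (there e)

largestBigInv : RunInvariant largestBig
largestBigInv = record
  { Inv           = LargestBigInv
  ; Fact          = NoFact
  ; inv-[]        = noBig [] []
  ; inv-small     = λ x x≤¼ inv → largestBigInv-skip x (small⇒¬medium x≤¼) (small⇒¬large x≤¼) inv , tt
  ; inv-oversized = λ x 1<x inv →
      largestBigInv-skip x (oversized⇒¬medium 1<x) (oversized⇒¬large 1<x) inv , tt
  ; inv-medium    = onMedium-preserves
  ; inv-large     = onLarge-preserves
  }
  where
  Preserved₄ : ∀ {n} → Vec ℚ n → List ℚ → ℚ → Decision → Set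
  Preserved₄ = Preserved LargestBigInv NoFact

  onMedium-pair : ∀ {n} {xs : Vec ℚ n} {h₁ h₂} x → Medium x → LargestBigInv xs (h₁ ∷ h₂ ∷ []) →
                  Preserved₄ xs (h₁ ∷ h₂ ∷ []) x (onMedium largestBig (h₁ ∷ h₂ ∷ []) x)
  onMedium-pair {h₁ = h₁} {h₂} x m (largestPair m₁ m₂ b a ps) with h₁ ≤? h₂
  ... | yes h₁≤h₂ with h₁ <? x
  ...   | yes h₁<x = accepting-fits (dropAt 0) (medium+medium-fits m m₂)
                       (largestPair m m₂ (medium⇒¬large m ∷ b)
                          ((λ _ → inj₁ ≤-refl) ∷ All.map (λ f m′ → inj₂ (≤max h₁≤h₂ (f m′))) a)
                          (All.map (λ f _ m′ → +-monoʳ-≤ x (≤max h₁≤h₂ (f m′))) a ∷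
                           AllPairs.map (λ f my mz → ≤-trans (f my mz) (+-monoˡ-≤ h₂ (<⇒≤ h₁<x))) ps) , tt)
  ...   | no h₁≮x  = rejecting
                       (largestPair m₁ m₂ (medium⇒¬large m ∷ b) ((λ _ → inj₁ (≮⇒≥ h₁≮x)) ∷ a)
                          (All.map (λ f _ m′ → +-mono-≤ (≮⇒≥ h₁≮x) (≤max h₁≤h₂ (f m′))) a ∷ ps)) tt
  onMedium-pair {h₁ = h₁} {h₂} x m (largestPair m₁ m₂ b a ps) | no h₁≰h₂ with h₂ <? x
  ...   | yes h₂<x = accepting-fits (dropAt 1) (medium+medium-fits m m₁)
                       (largestPair m m₁ (medium⇒¬large m ∷ b)
                          ((λ _ → inj₁ ≤-refl) ∷ All.map (λ f m′ → inj₂ (≤max h₂≤h₁ (swap (f m′)))) a)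
                          (All.map (λ f _ m′ → +-monoʳ-≤ x (≤max h₂≤h₁ (swap (f m′)))) a ∷
                           AllPairs.map (λ f my mz → ≤-trans (f my mz) h₁+h₂≤x+h₁) ps) , tt)
    where
    h₂≤h₁ : h₂ ≤ h₁
    h₂≤h₁ = <⇒≤ (≰⇒> h₁≰h₂)
    h₁+h₂≤x+h₁ : h₁ + h₂ ≤ x + h₁
    h₁+h₂≤x+h₁ = subst (h₁ + h₂ ≤_) (+-comm h₁ x) (+-monoʳ-≤ h₁ (<⇒≤ h₂<x))
  ...   | no h₂≮x  = rejecting
                       (largestPair m₁ m₂ (medium⇒¬large m ∷ b) ((λ _ → inj₂ (≮⇒≥ h₂≮x)) ∷ a)
                          (All.map (λ f _ m′ → subst (_≤ h₁ + h₂) (+-comm _ x)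
                             (+-mono-≤ (≤max (<⇒≤ (≰⇒> h₁≰h₂)) (swap (f m′))) (≮⇒≥ h₂≮x))) a ∷ ps)) tt

  onMedium-preserves : ∀ {n} {xs : Vec ℚ n} {held} x → Medium x → LargestBigInv xs held →
                       Preserved₄ xs held x (onMedium largestBig held x)
  onMedium-preserves x m (noBig a b) =
    accepting-fits keepAll (medium-fits m)
      (soleMedium m (medium⇒¬large m ∷ b) ((λ _ → ≤-refl) ∷ All.map (λ ¬m m′ → ⊥-elim (¬m m′)) a)
         (All.map (λ ¬m _ m′ → ¬m m′) a ∷ allPairs-fromAll (λ _ ¬m m′ _ → ¬m m′) a) , tt)
  onMedium-preserves x m (soleMedium {h} mh b a ps) with ½ <? h
  ... | yes ½<h = ⊥-elim (<⇒≱ ½<h (proj₂ mh))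
  ... | no _    = accepting-fits keepAll (medium+medium-fits m mh)
                    (largestPair m mh (medium⇒¬large m ∷ b)
                       ((λ _ → inj₁ ≤-refl) ∷ All.map (λ f m′ → inj₂ (f m′)) a)
                       (All.map (λ f _ m′ → +-monoʳ-≤ x (f m′)) a ∷
                        AllPairs.map (λ f my mz → ⊥-elim (f my mz)) ps) , tt)
  onMedium-preserves x m inv@(largestPair _ _ _ _ _) = onMedium-pair x m inv
  onMedium-preserves x m (largestLarge {h} l a e) with ½ <? h
  ... | yes _   = rejecting (largestLarge l ((λ l′ → ⊥-elim (medium⇒¬large m l′)) ∷ a) (there e)) tt
  ... | no ½≮h  = ⊥-elim (½≮h (proj₁ l))

  firstLarge : ∀ {n} {xs : Vec ℚ n} {x} → Large x → All (λ y → ¬ Large y) xs →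
               LargestBigInv (x ∷ xs) (x ∷ [])
  firstLarge l b =
    largestLarge l ((λ _ → ≤-refl) ∷ All.map (λ ¬l l′ → ⊥-elim (¬l l′)) b) (here (l , ≤-refl))

  onLarge-preserves : ∀ {n} {xs : Vec ℚ n} {held} x → Large x → LargestBigInv xs held →
                      Preserved₄ xs held x (onLarge largestBig held x)
  onLarge-preserves x l@(_ , x<¾) (noBig _ b) =
    accepting-fits dropAll (alone-fits x<¾) (firstLarge l b , tt)
  onLarge-preserves x l@(_ , x<¾) (soleMedium {h} mh b _ _) with ½ <? h
  ... | yes ½<h = ⊥-elim (<⇒≱ ½<h (proj₂ mh))
  ... | no _    = accepting-fits dropAll (alone-fits x<¾)
                    (firstLarge l b , tt)
  onLarge-preserves x l@(_ , x<¾) (largestPair _ _ b _ _) =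
    accepting-fits dropAll (alone-fits x<¾) (firstLarge l b , tt)
  onLarge-preserves x l@(_ , x<¾) (largestLarge {h} lh a e) with ½ <? h
  ... | no ½≮h = ⊥-elim (½≮h (proj₁ lh))
  ... | yes _ with h <? x
  ...   | yes h<x = accepting-fits dropAll (alone-fits x<¾)
                      (largestLarge l ((λ _ → ≤-refl) ∷ All.map (λ f l′ → ≤-trans (f l′) (<⇒≤ h<x)) a)
                         (here (l , ≤-refl)) , tt)
  ...   | no h≮x  = rejecting (largestLarge lh ((λ _ → ≮⇒≥ h≮x) ∷ a) (there e)) tt

-- The fallback policy

MixedOverflow : ℚ → ℚ → Set
MixedOverflow y z = (Medium y → Large z → 1ℚ < y + z) × (Large y → Medium z → 1ℚ < y + z)

MediumPairBelow¾ : ℚ → ℚ → Set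
MediumPairBelow¾ y z = Medium y → Medium z → y + z < ¾

MediumTripleOverflow : ℚ → ℚ → ℚ → Set
MediumTripleOverflow x y z = Medium x → Medium y → Medium z → 1ℚ < x + (y + z)

AllTriples : (ℚ → ℚ → ℚ → Set) → ∀ {n} → Vec ℚ n → Set
AllTriples T []       = ⊤
AllTriples T (x ∷ xs) = AllPairs (T x) xs × AllTriples T xs

AllTriplesᴸ : (ℚ → ℚ → ℚ → Set) → List ℚ → Set
AllTriplesᴸ T []       = ⊤
AllTriplesᴸ T (x ∷ xs) = AllPairsᴸ (T x) xs × AllTriplesᴸ T xs

mixedOverflow : ∀ {n} (xs : Vec ℚ n) → Facts MediumMissesLarge xs → Facts OverflowsWithMediums xs →
                AllPairs MixedOverflow xs
mixedOverflow []       _          _                = []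
mixedOverflow (x ∷ xs) (f₁ , fs₁) ((f₂ , _) , fs₂) = All.zip (f₁ , f₂) ∷ mixedOverflow xs fs₁ fs₂

mediumPairsBelow¾ : ∀ {n} (xs : Vec ℚ n) → Facts MediumPairsBelow¾ xs → AllPairs MediumPairBelow¾ xs
mediumPairsBelow¾ []       _        = []
mediumPairsBelow¾ (x ∷ xs) (f , fs) = f ∷ mediumPairsBelow¾ xs fs

mediumTriplesOverflow : ∀ {n} (xs : Vec ℚ n) → Facts OverflowsWithMediums xs →
                        AllTriples MediumTripleOverflow xs
mediumTriplesOverflow []       _              = tt
mediumTriplesOverflow (x ∷ xs) ((_ , f) , fs) = f , mediumTriplesOverflow xs fs

Any-lookup-satisfies : ∀ {P : ℚ → Set} {n} {xs : Vec ℚ n} (e : Any P xs) → P (Any.lookup e)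
Any-lookup-satisfies (here p)  = p
Any-lookup-satisfies (there e) = Any-lookup-satisfies e

overflowsWithLarge : ∀ {P : ℚ → Set} {n} {xs : Vec ℚ n} → AllPairs MixedOverflow xs →
                     (e : Any (λ y → Large y × P y) xs) → All (λ z → Medium z → 1ℚ < Any.lookup e + z) xs
overflowsWithLarge (o ∷ _) (here (l , _)) =
  (λ m → ⊥-elim (medium⇒¬large m l)) ∷ All.map (λ (_ , large+medium) m → large+medium l m) o
overflowsWithLarge {xs = x ∷ _} (o ∷ os) (there e) =
  (λ m → let (mixed , (l , _)) = All.lookupAny o e in subst (1ℚ <_) (+-comm x _) (proj₁ mixed m l)) ∷
  overflowsWithLarge os e

All-bigItems : ∀ {P : ℚ → Set} {n} {xs : Vec ℚ n} bs → All P xs → Allᴸ P (bigItems xs bs)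
All-bigItems                []           []       = []
All-bigItems                (false ∷ bs) (_ ∷ ps) = All-bigItems bs ps
All-bigItems {xs = x ∷ _} (true  ∷ bs) (p ∷ ps) with isBig x
... | true  = p ∷ All-bigItems bs ps
... | false = All-bigItems bs ps

AllPairs-bigItems : ∀ {R : ℚ → ℚ → Set} {n} {xs : Vec ℚ n} bs → AllPairs R xs → AllPairsᴸ R (bigItems xs bs)
AllPairs-bigItems                []           []       = []
AllPairs-bigItems                (false ∷ bs) (_ ∷ ps) = AllPairs-bigItems bs ps
AllPairs-bigItems {xs = x ∷ _} (true  ∷ bs) (p ∷ ps) with isBig x
... | true  = All-bigItems bs p ∷ AllPairs-bigItems bs ps
... | false = AllPairs-bigItems bs ps

AllTriples-bigItems : ∀ {T : ℚ → ℚ → ℚ → Set} {n} {xs : Vec ℚ n} bs → AllTriples T xs →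
                      AllTriplesᴸ T (bigItems xs bs)
AllTriples-bigItems {xs = []}    []           _        = tt
AllTriples-bigItems {xs = _ ∷ _} (false ∷ bs) (_ , ts) = AllTriples-bigItems bs ts
AllTriples-bigItems {xs = x ∷ _} (true  ∷ bs) (t , ts) with isBig x
... | true  = AllPairs-bigItems bs t , AllTriples-bigItems bs ts
... | false = AllTriples-bigItems bs ts

bigItems-big : ∀ {n} (xs : Vec ℚ n) bs → Allᴸ Big (bigItems xs bs)
bigItems-big []       []           = []
bigItems-big (_ ∷ xs) (false ∷ bs) = bigItems-big xs bs
bigItems-big (x ∷ xs) (true  ∷ bs) with classify x
... | small _     = bigItems-big xs bs
... | medium m    = inj₁ m ∷ bigItems-big xs bs
... | large l     = inj₂ l ∷ bigItems-big xs bs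
... | huge _ _    = bigItems-big xs bs
... | oversized _ = bigItems-big xs bs

data BigShape : List ℚ → Set where
  none       : BigShape []
  one        : ∀ y → BigShape (y ∷ [])
  twoMediums : ∀ {y z} → Medium y → Medium z → BigShape (y ∷ z ∷ [])

mediums⊎overflow : ∀ {y z} → Big y → Big z → MixedOverflow y z → (Medium y × Medium z) ⊎ 1ℚ < y + z
mediums⊎overflow (inj₁ my) (inj₁ mz) _ = inj₁ (my , mz)
mediums⊎overflow (inj₁ my) (inj₂ lz) o = inj₂ (proj₁ o my lz)
mediums⊎overflow (inj₂ ly) (inj₁ mz) o = inj₂ (proj₂ o ly mz)
mediums⊎overflow (inj₂ ly) (inj₂ lz) _ = inj₂ (+-mono-< (proj₁ ly) (proj₁ lz))

three-bigs-overflow : ∀ {y z w} → 0ℚ < z → 0ℚ < w → Big y → Big z → Big w →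
                      MixedOverflow y z → MixedOverflow y w → MediumTripleOverflow y z w → 1ℚ < y + (z + w)
three-bigs-overflow {y} {z} {w} 0<z 0<w by bz bw oz ow t
  with mediums⊎overflow by bz oz | mediums⊎overflow by bw ow
... | inj₂ 1<y+z     | _              = <-≤-trans 1<y+z (+-monoʳ-≤ y (p≤p+q z (<⇒≤ 0<w)))
... | inj₁ _         | inj₂ 1<y+w     = <-≤-trans 1<y+w (+-monoʳ-≤ y (p≤q+p w (<⇒≤ 0<z)))
... | inj₁ (my , mz) | inj₁ (_ , mw) = t my mz mw

bigShape : ∀ ys → Allᴸ Big ys → Allᴸ (0ℚ <_) ys → AllPairsᴸ MixedOverflow ys →
           AllTriplesᴸ MediumTripleOverflow ys → sum ys ≤ 1ℚ → BigShape ys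
bigShape []           _ _ _ _ _ = none
bigShape (y ∷ [])     _ _ _ _ _ = one y
bigShape (y ∷ z ∷ []) (by ∷ bz ∷ []) _ ((o ∷ []) ∷ _) _ fit with mediums⊎overflow by bz o
... | inj₁ (my , mz) = twoMediums my mz
... | inj₂ 1<y+z     = ⊥-elim (<⇒≱ 1<y+z (subst (_≤ 1ℚ) (x+[h]≡x+h y z) fit))
bigShape (y ∷ z ∷ w ∷ ys) (by ∷ bz ∷ bw ∷ _) (_ ∷ 0<z ∷ 0<w ∷ ps) ((oz ∷ ow ∷ _) ∷ _)
         (((t ∷ _) ∷ _) , _) fit =
  ⊥-elim (<⇒≱ (three-bigs-overflow 0<z 0<w by bz bw oz ow t)
               (≤-trans (+-monoʳ-≤ y (+-monoʳ-≤ z (p≤p+q w (sum-nonNeg ps)))) fit))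


big∧¬large⇒medium : ∀ {y} → Big y → ¬ Large y → Medium y
big∧¬large⇒medium (inj₁ m) _  = m
big∧¬large⇒medium (inj₂ l) ¬l = ⊥-elim (¬l l)

noBig-bound : ∀ ys → Allᴸ Big ys → Allᴸ (λ y → ¬ Medium y) ys → Allᴸ (λ y → ¬ Large y) ys → sum ys ≤ sum []
noBig-bound []      _              _          _          = ≤-refl
noBig-bound (_ ∷ _) (inj₁ m ∷ _) (¬m ∷ _) _          = ⊥-elim (¬m m)
noBig-bound (_ ∷ _) (inj₂ l ∷ _) _          (¬l ∷ _) = ⊥-elim (¬l l)

soleMedium-bound : ∀ {h} ys → BigShape ys → Medium h → Allᴸ Big ys → Allᴸ (λ y → ¬ Large y) ys →
                   Allᴸ (λ y → Medium y → y ≤ h) ys → AllPairsᴸ (λ y z → Medium y → ¬ Medium z) ys →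
                   sum ys ≤ sum (h ∷ [])
soleMedium-bound .[]           none                mh _ _ _ _ = sum-nonNeg (medium⇒pos mh ∷ [])
soleMedium-bound .(y ∷ [])     (one y)             _  (b ∷ _) (¬l ∷ _) (y≤h ∷ _) _ =
  +-monoˡ-≤ 0ℚ (y≤h (big∧¬large⇒medium b ¬l))
soleMedium-bound .(_ ∷ _ ∷ []) (twoMediums my mz) _  _ _ _ ((f ∷ _) ∷ _) = ⊥-elim (f my mz)

largestPair-bound : ∀ {h₁ h₂} ys → BigShape ys → Medium h₁ → Medium h₂ → Allᴸ Big ys →
                    Allᴸ (λ y → ¬ Large y) ys → Allᴸ (λ y → Medium y → y ≤ h₁ ⊎ y ≤ h₂) ys →
                    AllPairsᴸ (λ y z → Medium y → Medium z → y + z ≤ h₁ + h₂) ys →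
                    sum ys ≤ sum (h₁ ∷ h₂ ∷ [])
largestPair-bound .[] none m₁ m₂ _ _ _ _ = sum-nonNeg (medium⇒pos m₁ ∷ medium⇒pos m₂ ∷ [])
largestPair-bound {h₁} {h₂} .(y ∷ []) (one y) m₁ m₂ (b ∷ _) (¬l ∷ _) (f ∷ _) _ =
  subst₂ _≤_ (sym (sum-[y] y)) (sym (sum-[y,z] h₁ h₂)) (y≤h₁+h₂ (f (big∧¬large⇒medium b ¬l)))
  where
  y≤h₁+h₂ : y ≤ h₁ ⊎ y ≤ h₂ → y ≤ h₁ + h₂
  y≤h₁+h₂ (inj₁ y≤h₁) = ≤-trans y≤h₁ (p≤p+q h₁ (<⇒≤ (medium⇒pos m₂)))
  y≤h₁+h₂ (inj₂ y≤h₂) = ≤-trans y≤h₂ (p≤q+p h₂ (<⇒≤ (medium⇒pos m₁)))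
largestPair-bound {h₁} {h₂} .(y ∷ z ∷ []) (twoMediums {y} {z} my mz) _ _ _ _ _ ((f ∷ _) ∷ _) =
  subst₂ _≤_ (sym (sum-[y,z] y z)) (sym (sum-[y,z] h₁ h₂)) (f my mz)

-- Two mediums that each overflow together with y₀ but fit together force y₀ > ⅝, and ¾ < 4/3 · ⅝.
largestLarge-bound : ∀ {h y₀} ys → BigShape ys → Large h → y₀ ≤ h → Allᴸ Big ys →
                     Allᴸ (λ y → Large y → y ≤ h) ys → Allᴸ (λ z → Medium z → 1ℚ < y₀ + z) ys →
                     AllPairsᴸ MediumPairBelow¾ ys → sum ys ≤ four-thirds * sum (h ∷ [])
largestLarge-bound {h} {y₀} ys shape lh@(½<h , _) y₀≤h bs ls os ps = bound ys shape bs ls os ps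
  where
  0≤[h] : 0ℚ ≤ sum (h ∷ [])
  0≤[h] = sum-nonNeg (<-trans (<-trans 0<¼ ¼<½) ½<h ∷ [])
  bound : ∀ ys → BigShape ys → Allᴸ Big ys → Allᴸ (λ y → Large y → y ≤ h) ys →
          Allᴸ (λ z → Medium z → 1ℚ < y₀ + z) ys → AllPairsᴸ MediumPairBelow¾ ys →
          sum ys ≤ four-thirds * sum (h ∷ [])
  bound .[]       none    _ _ _ _ = ≤⇒≤four-thirds* 0≤[h] 0≤[h]
  bound .(y ∷ []) (one y) (inj₁ (_ , y≤½) ∷ _) _ _ _ =
    ≤⇒≤four-thirds* 0≤[h] (+-monoˡ-≤ 0ℚ (≤-trans y≤½ (<⇒≤ ½<h)))
  bound .(y ∷ []) (one y) (inj₂ l ∷ _) (y≤h ∷ _) _ _ = ≤⇒≤four-thirds* 0≤[h] (+-monoˡ-≤ 0ℚ (y≤h l))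
  bound .(y ∷ z ∷ []) (twoMediums {y} {z} my mz) _ _ (oy ∷ oz ∷ _) ((below ∷ _) ∷ _) = begin
    sum (y ∷ z ∷ [])         ≡⟨ sum-[y,z] y z ⟩
    y + z                    <⟨ below my mz ⟩
    ¾                        ≤⟨ toWitness {a? = ¾ ≤? four-thirds * ⅝} tt ⟩
    four-thirds * ⅝          ≤⟨ *-monoˡ-≤-nonNeg four-thirds (<⇒≤ (<-≤-trans ⅝<y₀ y₀≤h)) ⟩
    four-thirds * h          ≡⟨ cong (four-thirds *_) (sum-[y] h) ⟨
    four-thirds * sum (h ∷ []) ∎
    where
    open ≤-Reasoning
    2<2y₀+y+z : 1ℚ + 1ℚ < (y₀ + y₀) + (y + z)
    2<2y₀+y+z = subst (1ℚ + 1ℚ <_) (interchange y₀ y y₀ z) (+-mono-< (oy my) (oz mz))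
    ⅝<y₀ : ⅝ < y₀
    ⅝<y₀ = ≰⇒> (λ y₀≤⅝ → <⇒≱ 2<2y₀+y+z (≤-trans (<⇒≤ (+-mono-≤-< (+-mono-≤ y₀≤⅝ y₀≤⅝) (below my mz)))
                                                  (≤-reflexive {⅝ + ⅝ + ¾} refl)))

bigItems-bound : ∀ {n} {I : Vec ℚ n} {held} S → LargestBigInv I held → AllPositive I →
                 AllPairs MixedOverflow I → AllPairs MediumPairBelow¾ I →
                 AllTriples MediumTripleOverflow I →
                 sum (bigItems I S) ≤ 1ℚ → sum (bigItems I S) ≤ four-thirds * sum held
bigItems-bound {I = I} S inv ps mixed pairs triples fit = bound inv
  where
  ys = bigItems I S
  bs = bigItems-big I S
  shape : BigShape ys
  shape = bigShape ys bs (All-bigItems S ps) (AllPairs-bigItems S mixed) (AllTriples-bigItems S triples) fit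
  bound : ∀ {held} → LargestBigInv I held → sum ys ≤ four-thirds * sum held
  bound (noBig a b) = ≤⇒≤four-thirds* ≤-refl (noBig-bound ys bs (All-bigItems S a) (All-bigItems S b))
  bound (soleMedium mh b a ps′) =
    ≤⇒≤four-thirds* (sum-nonNeg (medium⇒pos mh ∷ []))
      (soleMedium-bound ys shape mh bs (All-bigItems S b) (All-bigItems S a) (AllPairs-bigItems S ps′))
  bound (largestPair m₁ m₂ b a ps′) =
    ≤⇒≤four-thirds* (sum-nonNeg (medium⇒pos m₁ ∷ medium⇒pos m₂ ∷ []))
      (largestPair-bound ys shape m₁ m₂ bs (All-bigItems S b) (All-bigItems S a) (AllPairs-bigItems S ps′))
  bound (largestLarge lh a e) =
    largestLarge-bound ys shape lh (proj₂ (Any-lookup-satisfies e)) bs (All-bigItems S a)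
      (All-bigItems S (overflowsWithLarge mixed e)) (AllPairs-bigItems S pairs)

nonBigSize≤smallTotal : ∀ {n} (I : Vec ℚ n) S → AllPositive I → All ¬Huge I → packedSize I S ≤ 1ℚ →
                        nonBigSize I S ≤ smallTotal I
nonBigSize≤smallTotal []       []           _        _          _   = ≤-refl
nonBigSize≤smallTotal (y ∷ I) (false ∷ S) (p ∷ ps) (_ ∷ nhs) fit with classify y
... | small _     = ≤-trans (nonBigSize≤smallTotal I S ps nhs fit) (p≤q+p _ (<⇒≤ p))
... | medium _    = nonBigSize≤smallTotal I S ps nhs fit
... | large _     = nonBigSize≤smallTotal I S ps nhs fit
... | huge _ _    = nonBigSize≤smallTotal I S ps nhs fit
... | oversized _ = nonBigSize≤smallTotal I S ps nhs fit
nonBigSize≤smallTotal (y ∷ I) (true ∷ S) (p ∷ ps) (nh ∷ nhs) fit with classify y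
... | small _     = +-monoʳ-≤ y (nonBigSize≤smallTotal I S ps nhs rest≤1)
  where rest≤1 = ≤-trans (p≤q+p (packedSize I S) (<⇒≤ p)) fit
... | medium _    = nonBigSize≤smallTotal I S ps nhs (≤-trans (p≤q+p (packedSize I S) (<⇒≤ p)) fit)
... | large _     = nonBigSize≤smallTotal I S ps nhs (≤-trans (p≤q+p (packedSize I S) (<⇒≤ p)) fit)
... | huge ¾≤y y≤1 = ⊥-elim (nh ¾≤y y≤1)
... | oversized 1<y = ⊥-elim (<⇒≱ 1<y (≤-trans (p≤p+q y (packedSize-nonNeg S ps)) fit))

-- The oracle

reaching¾⇒competitive : ∀ {n} (I : Vec ℚ n) S a → packedSize I S ≤ 1ℚ → ¾ ≤ gain algorithm a I →
                         packedSize I S ≤ four-thirds * gain algorithm a I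
reaching¾⇒competitive I S a fit ¾≤g = ≤-trans fit (*-monoˡ-≤-nonNeg four-thirds ¾≤g)

fallback-competitive : ∀ {n} (I : Vec ℚ n) S → AllPositive I → packedSize I S ≤ 1ℚ →
                       Unfrozen advice₁ I → Unfrozen advice₂ I → Unfrozen advice₃ I → Unfrozen advice₄ I →
                       packedSize I S ≤ four-thirds * gain algorithm advice₄ I
fallback-competitive I S ps fit u₁ u₂ u₃ u₄ = begin
  packedSize I S
    ≡⟨ packedSize-split I S ⟩
  sum (bigItems I S) + nonBigSize I S
    ≤⟨ +-mono-≤ bigPart smallPart ⟩
  four-thirds * sum held + four-thirds * smallTotal I
    ≡⟨ *-distribˡ-+ four-thirds (sum held) (smallTotal I) ⟨
  four-thirds * (sum held + smallTotal I)
    ≡⟨ cong (four-thirds *_) gain≡ ⟨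
  four-thirds * gain algorithm advice₄ I ∎
  where
  open ≤-Reasoning
  module R₁ = UnfrozenRun advice₁ smallestLargeInv
  module R₂ = UnfrozenRun advice₂ twoSmallestMediumInv
  module R₃ = UnfrozenRun advice₃ largestMediumInv
  module R₄ = UnfrozenRun advice₄ largestBigInv
  run₁ = R₁.run I ps u₁
  run₂ = R₂.run I ps u₂
  run₃ = R₃.run I ps u₃
  run₄ = R₄.run I ps u₄
  pack₄ = pack algorithm advice₄ I
  held = bigItems I pack₄
  gain≡ : gain algorithm advice₄ I ≡ sum held + smallTotal I
  gain≡ = trans (packedSize-split I pack₄) (cong (sum held +_) (R₄.Run.smallKept run₄))
  0≤smallTotal : 0ℚ ≤ smallTotal I
  0≤smallTotal = subst (0ℚ ≤_) (R₄.Run.smallKept run₄) (nonBigSize-nonNeg pack₄ ps)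
  big≤1 : sum (bigItems I S) ≤ 1ℚ
  big≤1 = ≤-trans (p≤p+q _ (nonBigSize-nonNeg S ps)) (subst (_≤ 1ℚ) (packedSize-split I S) fit)
  bigPart : sum (bigItems I S) ≤ four-thirds * sum held
  bigPart = bigItems-bound S (R₄.Run.invariant run₄) ps
          (mixedOverflow I (R₁.Run.facts run₁) (R₂.Run.facts run₂))
          (mediumPairsBelow¾ I (R₃.Run.facts run₃))
          (mediumTriplesOverflow I (R₂.Run.facts run₂)) big≤1
  smallPart : nonBigSize I S ≤ four-thirds * smallTotal I
  smallPart = ≤⇒≤four-thirds* 0≤smallTotal (nonBigSize≤smallTotal I S ps (R₁.Run.noHuge run₁) fit)

firstReaching : ∀ {A B C : Set} → Dec A → Dec B → Dec C → Advice
firstReaching (yes _) _       _       = advice₁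
firstReaching (no _)  (yes _) _       = advice₂
firstReaching (no _)  (no _)  (yes _) = advice₃
firstReaching (no _)  (no _)  (no _)  = advice₄

oracle : ∀ {n} → Vec ℚ n → Advice
oracle I =
  firstReaching (¾ ≤? gain algorithm advice₁ I) (¾ ≤? gain algorithm advice₂ I) (¾ ≤? gain algorithm advice₃ I)

firstReaching-competitive : ∀ {n} (I : Vec ℚ n) S → AllPositive I → packedSize I S ≤ 1ℚ →
  (d₁ : Dec (¾ ≤ gain algorithm advice₁ I)) (d₂ : Dec (¾ ≤ gain algorithm advice₂ I))
  (d₃ : Dec (¾ ≤ gain algorithm advice₃ I)) →
  packedSize I S ≤ four-thirds * gain algorithm (firstReaching d₁ d₂ d₃) I
firstReaching-competitive I S ps fit (yes r₁) _        _        = reaching¾⇒competitive I S advice₁ fit r₁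
firstReaching-competitive I S ps fit (no _)   (yes r₂) _        = reaching¾⇒competitive I S advice₂ fit r₂
firstReaching-competitive I S ps fit (no _)   (no _)   (yes r₃) = reaching¾⇒competitive I S advice₃ fit r₃
firstReaching-competitive I S ps fit (no u₁)  (no u₂)  (no u₃) with ¾ ≤? gain algorithm advice₄ I
... | yes r₄ = reaching¾⇒competitive I S advice₄ fit r₄
... | no u₄  = fallback-competitive I S ps fit u₁ u₂ u₃ u₄

theorem7 : Σ OnlineAlg (λ A → Σ (∀ {n} → Vec ℚ n → Advice) (λ oracle → StrictlyCompetitive four-thirds A oracle))
theorem7 = algorithm , oracle , λ I ps → allFit (oracle I) I , λ S fit →
  firstReaching-competitive I S ps fit
    (¾ ≤? gain algorithm advice₁ I) (¾ ≤? gain algorithm advice₂ I) (¾ ≤? gain algorithm advice₃ I)
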